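{- Let $q$ be a prime power such that $q^2+q+1$ is not prime, say $q^2+q+1=cd$ with integers $c,d\geq 2$. Let $\mathcal{D}=(\mathcal{P},\mathcal{B})$ be the design whose points and blocks are the points and lines of the Desarguesian projective plane $\mathrm{PG}_2(q)$ (so $\mathcal{D}$ is a $2$-$(cd,q+1,1)$ design with $v=cd$ and $k=q+1$). Let $G$ be a Singer cycle, i.e. a cyclic subgroup of $\mathrm{Aut}(\mathcal{D})$ of order $cd$ acting regularly on $\mathcal{P}$ (hence also regularly, in particular transitively, on $\mathcal{B}$), and let $\mathcal{C}$ be the $G$-invariant partition of $\mathcal{P}$ into $d$ classes of size $c$ given by the orbits of the unique cyclic subgroup of $G$ of order $c$. Then: (a) The Delandtsheer--Doyen parameters $(m,n)$ for $\mathcal{D}$ relative to $G$ and $\mathcal{C}$ are $m=\frac{d-1}{2}$ and $n=\frac{c-1}{2}$. (b) The group $G$ is permutationally isomorphic to a subgroup of $H\wr K$ where $H=\mathbb{Z}_c$ is the group induced on a class of $\mathcal{C}$, and $K=\mathbb{Z}_d$ is the group induced on $\mathcal{C}$. (c) $\mathrm{Rank}(H)=2n+1$ and $\mathrm{Rank}(K)=2m+1$, which are the largest possible values allowed by the general bounds $\mathrm{Rank}(H)\leq 2n+1$ and $\mathrm{Rank}(K)\leq 2m+1$. (d) For any $N>0$ there exists $q$ such that $q^2+q+1=cd$ with both $m>N$ and $n>N$.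
   Context: For a $2$-$(v,k,\lambda)$ design with a block-transitive automorphism group $G$ preserving a partition of the point set into $d\geq 2$ classes of size $c\geq 2$, the Delandtsheer--Doyen parameters are the positive integers $m,n$ with $c=(\binom{k}{2}-n)/m$ and $d=(\binom{k}{2}-m)/n$; here $n$ is the number of pairs of points of a block lying in the same class and $mc$ is the number of pairs of points of a block lying in different classes. For a transitive permutation group $X$, $\mathrm{Rank}(X)$ is the number of orbits of a point stabiliser. In general one has $\mathrm{Rank}(H)\leq 2n+1$ and $\mathrm{Rank}(K)\leq 2m+1$, where $H$ is the group induced on a class by its setwise stabiliser in $G$ and $K$ is the group induced by $G$ on the set of classes. -}

module Defs where

open import Level using (0ℓ)
open import Data.Nat using (ℕ; zero; suc; _+_; _*_; _<_; _≤_)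
open import Data.Nat.Primality using (Prime)
open import Data.Fin using (Fin)
open import Data.Product using (Σ; ∃; _×_; _,_; proj₁; proj₂)
open import Data.Sum using (_⊎_)
open import Data.Unit using (⊤)
open import Data.List using (List; []; _∷_; map; _++_; length; filter; upTo; allFin; concatMap)
open import Data.List.Relation.Unary.Any using (Any; any?)
open import Data.List.Relation.Unary.All using (All)
open import Data.List.Relation.Unary.AllPairs using (AllPairs)
open import Relation.Nullary using (¬_; Dec; yes; no)
open import Relation.Nullary.Decidable using (_×-dec_; ¬?)
open import Relation.Binary.PropositionalEquality using (_≡_; _≢_; refl; cong; cong₂)
open import Relation.Binary.Definitions using (DecidableEquality)
open import Algebra.Structures using (IsCommutativeRing)
open import Function.Bundles using (_↔_; Inverse)

IsPrimePower : ℕ → Set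
IsPrimePower q = ∃ λ p → ∃ λ k → Prime p × 1 ≤ k × q ≡ p Data.Nat.^ k

_≡_[mod_] : ℕ → ℕ → ℕ → Set
x ≡ y [mod m ] = ∃ λ k → (x ≡ y + k * m) ⊎ (y ≡ x + k * m)

iter : {A : Set} → ℕ → (A → A) → A → A
iter zero    f x = x
iter (suc n) f x = f (iter n f x)

pairs : {A : Set} → List A → List (A × A)
pairs []       = []
pairs (x ∷ xs) = map (x ,_) xs ++ pairs xs

-- "the relation R (an orbit relation) has exactly r classes on the subset S":
-- r pairwise unrelated representatives in S such that every element of S is
-- related to one of them.
HasOrbitCount : {A : Set} → (A → Set) → (A → A → Set) → ℕ → Set
HasOrbitCount {A} S R r =
  Σ (List A) λ reps → length reps ≡ r × All S reps
    × AllPairs (λ a b → ¬ R a b) reps × (∀ y → S y → Any (λ a → R a y) reps)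

record FiniteField (q : ℕ) : Set₁ where
  infixl 6 _+F_
  infixl 7 _*F_
  field
    Carrier  : Set
    _≟F_     : DecidableEquality Carrier
    _+F_     : Carrier → Carrier → Carrier
    _*F_     : Carrier → Carrier → Carrier
    -F_      : Carrier → Carrier
    0F       : Carrier
    1F       : Carrier
    isCommutativeRing : IsCommutativeRing _≡_ _+F_ _*F_ -F_ 0F 1F
    0≢1      : 0F ≢ 1F
    inverse  : ∀ x → x ≢ 0F → ∃ λ y → x *F y ≡ 1F
    enum     : Fin q ↔ Carrier

-- The Desarguesian projective plane PG(2,F): points are the 1-dimensional
-- subspaces of F³, represented by their unique normalised spanning vector
-- (1,y,z), (0,1,z) or (0,0,1).  Lines are the 2-dimensional subspaces, i.e.
-- kernels of nonzero linear forms, represented by the normalised coefficient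
-- vector in the same way; incidence is vanishing of the dot product.

module PG {q : ℕ} (F : FiniteField q) where
  open FiniteField F

  data Point : Set where
    pt1 : Carrier → Carrier → Point
    pt2 : Carrier → Point
    pt3 : Point

  Line : Set
  Line = Point

  coords : Point → Carrier × Carrier × Carrier
  coords (pt1 y z) = 1F , y , z
  coords (pt2 z)   = 0F , 1F , z
  coords pt3       = 0F , 0F , 1F

  _I_ : Point → Line → Set
  p I L with coords p | coords L
  ... | (x , y , z) | (a , b , c) = a *F x +F b *F y +F c *F z ≡ 0F

  _I?_ : ∀ p L → Dec (p I L)
  p I? L with coords p | coords L
  ... | (x , y , z) | (a , b , c) = (a *F x +F b *F y +F c *F z) ≟F 0F

  _≟P_ : DecidableEquality Point
  pt1 y z ≟P pt1 y' z' with y ≟F y' | z ≟F z'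
  ... | yes refl | yes refl = yes refl
  ... | no ne | _ = no λ { refl → ne refl }
  ... | yes _ | no ne = no λ { refl → ne refl }
  pt1 _ _ ≟P pt2 _ = no λ ()
  pt1 _ _ ≟P pt3 = no λ ()
  pt2 _ ≟P pt1 _ _ = no λ ()
  pt2 z ≟P pt2 z' with z ≟F z'
  ... | yes refl = yes refl
  ... | no ne = no λ { refl → ne refl }
  pt2 _ ≟P pt3 = no λ ()
  pt3 ≟P pt1 _ _ = no λ ()
  pt3 ≟P pt2 _ = no λ ()
  pt3 ≟P pt3 = yes refl

  elems : List Carrier
  elems = map (Inverse.to enum) (allFin q)

  pointsList : List Point
  pointsList = concatMap (λ y → map (pt1 y) elems) elems ++ map pt2 elems ++ (pt3 ∷ [])

  IsCollineation : (Point ↔ Point) → Set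
  IsCollineation σ = ∀ L → ∃ λ L' → ∀ p →
    (p I L → Inverse.to σ p I L') × (Inverse.to σ p I L' → p I L)

  -- Given the generator s of the cyclic group G and d (so that ⟨s^d⟩ is the
  -- subgroup of order c), p and p' lie in the same class iff p' is in the
  -- ⟨s^d⟩-orbit { s^(d j) p : j < c } of p.
  module Classes (s : Point → Point) (c d : ℕ) where

    SameClass : Point → Point → Set
    SameClass p p' = Any (λ j → iter (d * j) s p ≡ p') (upTo c)

    sameClass? : ∀ p p' → Dec (SameClass p p')
    sameClass? p p' = any? (λ j → iter (d * j) s p ≟P p') (upTo c)

    samePairs : Line → ℕ
    samePairs L = length (filter
      (λ pp → (proj₁ pp I? L) ×-dec (proj₂ pp I? L) ×-dec sameClass? (proj₁ pp) (proj₂ pp))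
      (pairs pointsList))

    diffPairs : Line → ℕ
    diffPairs L = length (filter
      (λ pp → (proj₁ pp I? L) ×-dec (proj₂ pp I? L) ×-dec ¬? (sameClass? (proj₁ pp) (proj₂ pp)))
      (pairs pointsList))

    StabClass : Point → ℕ → Set
    StabClass x i = ∀ p → SameClass x p → SameClass x (iter i s p)

    -- orbits of the stabiliser of x in the group H induced on the class of x
    -- by its setwise stabiliser in G = ⟨s⟩
    HOrbit : Point → Point → Point → Set
    HOrbit x y z = ∃ λ i → StabClass x i × iter i s x ≡ x × iter i s y ≡ z

    RankH : Point → ℕ → Set
    RankH x r = HasOrbitCount (SameClass x) (HOrbit x) r

    -- orbits of the stabiliser of the class of x in the group K induced by G
    -- on the set of classes (a class being represented by any of its points)
    KOrbit : Point → Point → Point → Set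
    KOrbit x y z = ∃ λ i → StabClass x i × SameClass (iter i s y) z

    RankK : Point → ℕ → Set
    RankK x r = HasOrbitCount (λ _ → ⊤) (KOrbit x) r

-- A Singer cycle s acts regularly on the q² + q + 1 points of PG(2, q), and each line ℓ is a
-- planar difference set: for 0 < a < q² + q + 1 exactly one point x of ℓ has s^a x ∈ ℓ, since
-- some such x exists (two lines meet) and the (q + 1) q ordered pairs of distinct points of ℓ are
-- spread over the q² + q nonzero exponents a.  The class of x is {s^(d j) x : j < c}, so the
-- ordered same-class pairs on ℓ correspond to the c - 1 exponents d j with 0 < j < c: this gives
-- 2 n = c - 1, and counting all pairs on ℓ together with q² + q + 1 = c d gives m c
-- different-class pairs with 2 m = d - 1.  Writing every point as s^(r + d u) p₀ identifies the
-- classes with the values of r, and s^i adds i to r with a carry into u that depends only on r,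
-- which is the embedding into Z_c ≀ Z_d.  As G is abelian and regular, point stabilisers in H and
-- K are trivial, so their ranks are c and d.  For (d), q = 4^k gives the factorisation
-- q² + q + 1 = (q + 2^k + 1) (q - 2^k + 1) into two large factors.

module Submission where

open import Level using (0ℓ)
open import Data.Nat using (ℕ; zero; suc; pred; _+_; _*_; _∸_; _/_; _%_; _^_; _<_; _≤_; z≤n; s≤s; NonZero; >-nonZero⁻¹)
open import Data.Nat.Properties
open import Data.Nat.DivMod
open import Data.Nat.Divisibility using (divides)
open import Data.Nat.Primality using (prime[2])
open import Data.Nat.Tactic.RingSolver using (solve-∀)
open import Data.Fin using (Fin; toℕ; fromℕ<)
open import Data.Fin.Properties using (toℕ-fromℕ<; toℕ-injective; toℕ<n)
open import Data.Product using (Σ; ∃; _×_; _,_; proj₁; proj₂)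
open import Data.Sum using (_⊎_; inj₁; inj₂)
open import Data.Empty using (⊥-elim)
open import Data.Unit using (⊤; tt)
open import Data.List using (List; []; _∷_; map; _++_; length; filter; upTo; applyUpTo; concatMap; allFin; cartesianProductWith)
open import Data.List.Properties using (length-applyUpTo; length-upTo; length-map; length-tabulate)
open import Data.List.Relation.Unary.Any using (Any; here; there; any?)
import Data.List.Relation.Unary.Any as Any
open import Data.List.Relation.Unary.Any.Properties using (applyUpTo⁺; applyUpTo⁻)
import Data.List.Relation.Unary.All as All
open import Data.List.Relation.Unary.AllPairs using (_∷_)
import Data.List.Relation.Unary.AllPairs as AllPairs
import Data.List.Relation.Unary.AllPairs.Properties as AllPairs
open import Data.List.Membership.Propositional using (_∈_; _∉_)
open import Data.List.Membership.DecPropositional using (_∈?_)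
open import Data.List.Membership.Propositional.Properties
  using (∈-map⁺; ∈-map⁻; ∈-allFin; ∈-++⁺ˡ; ∈-++⁺ʳ; ∈-++⁻; ∈-cartesianProductWith⁺; ∈-cartesianProductWith⁻;
         ∈-applyUpTo⁺; ∈-applyUpTo⁻; ∈-upTo⁻)
open import Data.List.Relation.Unary.Unique.Propositional using (Unique)
import Data.List.Relation.Unary.Unique.Propositional.Properties as Unique
open import Relation.Nullary using (¬_; Dec; yes; no)
open import Relation.Nullary.Decidable using (_×-dec_; ¬?)
open import Relation.Unary using (Pred; Decidable)
open import Relation.Binary.Definitions using (DecidableEquality; tri<; tri≈; tri>)
open import Relation.Binary.PropositionalEquality
open import Algebra.Bundles using (CommutativeRing)
open import Function using (_∘′_)
open import Function.Bundles using (_↔_; _⇔_; Inverse; mk↔ₛ′; mk⇔)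
open import Defs


𝟙 : ∀ {P : Set} → Dec P → ℕ
𝟙 (yes _) = 1
𝟙 (no _)  = 0

∑ : ∀ {A : Set} → (A → ℕ) → List A → ℕ
∑ f []       = 0
∑ f (x ∷ xs) = f x + ∑ f xs

module _ {P : Set} where

  𝟙-yes : (P? : Dec P) → P → 𝟙 P? ≡ 1
  𝟙-yes (yes _) _ = refl
  𝟙-yes (no ¬p) p = ⊥-elim (¬p p)

  𝟙-no : (P? : Dec P) → ¬ P → 𝟙 P? ≡ 0
  𝟙-no (yes p) ¬p = ⊥-elim (¬p p)
  𝟙-no (no _)  _  = refl

  𝟙-idem : (P? : Dec P) → 𝟙 P? * 𝟙 P? ≡ 𝟙 P?
  𝟙-idem (yes _) = refl
  𝟙-idem (no _)  = refl

  𝟙-¬ : (P? : Dec P) → 𝟙 P? + 𝟙 (¬? P?) ≡ 1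
  𝟙-¬ (yes _) = refl
  𝟙-¬ (no _)  = refl

module _ {P Q : Set} where

  𝟙-× : (P? : Dec P) (Q? : Dec Q) → 𝟙 (P? ×-dec Q?) ≡ 𝟙 P? * 𝟙 Q?
  𝟙-× (yes _) (yes _) = refl
  𝟙-× (yes _) (no _)  = refl
  𝟙-× (no _)  _       = refl

  𝟙-cong : (P → Q) → (Q → P) → (P? : Dec P) (Q? : Dec Q) → 𝟙 P? ≡ 𝟙 Q?
  𝟙-cong f g P? (yes q) = 𝟙-yes P? (g q)
  𝟙-cong f g P? (no ¬q) = 𝟙-no P? (λ p → ¬q (f p))

module _ {A : Set} where

  length-filter≡∑𝟙 : ∀ {P : Pred A _} (P? : Decidable P) xs →
                      length (filter P? xs) ≡ ∑ (λ x → 𝟙 (P? x)) xs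
  length-filter≡∑𝟙 P? [] = refl
  length-filter≡∑𝟙 P? (x ∷ xs) with P? x
  ... | yes _ = cong suc (length-filter≡∑𝟙 P? xs)
  ... | no _  = length-filter≡∑𝟙 P? xs

  ∑-cong : ∀ {f g : A → ℕ} xs → (∀ x → x ∈ xs → f x ≡ g x) → ∑ f xs ≡ ∑ g xs
  ∑-cong []       f≡g = refl
  ∑-cong (x ∷ xs) f≡g = cong₂ _+_ (f≡g x (here refl)) (∑-cong xs (λ y y∈ → f≡g y (there y∈)))

  ∑-ext : ∀ {f g : A → ℕ} xs → (∀ x → f x ≡ g x) → ∑ f xs ≡ ∑ g xs
  ∑-ext xs f≡g = ∑-cong xs (λ x _ → f≡g x)

  ∑-++ : ∀ (f : A → ℕ) xs ys → ∑ f (xs ++ ys) ≡ ∑ f xs + ∑ f ys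
  ∑-++ f []       ys = refl
  ∑-++ f (x ∷ xs) ys = trans (cong (f x +_) (∑-++ f xs ys)) (sym (+-assoc (f x) _ _))

  ∑-+ : ∀ (f g : A → ℕ) xs → ∑ (λ x → f x + g x) xs ≡ ∑ f xs + ∑ g xs
  ∑-+ f g []       = refl
  ∑-+ f g (x ∷ xs) = trans (cong (f x + g x +_) (∑-+ f g xs)) (+-+-swap (f x) (g x) _ _)
    where
    +-+-swap : ∀ a b c d → a + b + (c + d) ≡ a + c + (b + d)
    +-+-swap = solve-∀

  ∑-*ˡ : ∀ k (f : A → ℕ) xs → ∑ (λ x → k * f x) xs ≡ k * ∑ f xs
  ∑-*ˡ k f []       = sym (*-zeroʳ k)
  ∑-*ˡ k f (x ∷ xs) = trans (cong (k * f x +_) (∑-*ˡ k f xs)) (sym (*-distribˡ-+ k (f x) _))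

  ∑-const : ∀ k (xs : List A) → ∑ (λ _ → k) xs ≡ length xs * k
  ∑-const k []       = refl
  ∑-const k (x ∷ xs) = cong (k +_) (∑-const k xs)

  ∑-zero : ∀ (f : A → ℕ) xs → (∀ x → x ∈ xs → f x ≡ 0) → ∑ f xs ≡ 0
  ∑-zero f xs f≡0 = trans (∑-cong xs f≡0) (trans (∑-const 0 xs) (*-zeroʳ (length xs)))

  ∑-≥-term : ∀ (f : A → ℕ) {xs x} → x ∈ xs → f x ≤ ∑ f xs
  ∑-≥-term f {y ∷ ys} (here refl) = m≤m+n (f y) _
  ∑-≥-term f {y ∷ ys} (there x∈) = ≤-trans (∑-≥-term f x∈) (m≤n+m _ (f y))

  ∑-≥-length : ∀ (f : A → ℕ) xs → (∀ x → x ∈ xs → 1 ≤ f x) → length xs ≤ ∑ f xs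
  ∑-≥-length f []       pos = z≤n
  ∑-≥-length f (x ∷ xs) pos = +-mono-≤ (pos x (here refl)) (∑-≥-length f xs (λ y y∈ → pos y (there y∈)))

  ∑≡length⇒≡1 : ∀ (f : A → ℕ) xs → (∀ x → x ∈ xs → 1 ≤ f x) → ∑ f xs ≡ length xs →
                ∀ x → x ∈ xs → f x ≡ 1
  ∑≡length⇒≡1 f (y ∷ ys) pos sum≡ x x∈ = go x∈
    where
    pos-ys : ∀ x → x ∈ ys → 1 ≤ f x
    pos-ys z z∈ = pos z (there z∈)
    fy≡1 : f y ≡ 1
    fy≡1 = ≤-antisym (+-cancelʳ-≤ (∑ f ys) (f y) 1
             (≤-trans (≤-reflexive sum≡) (+-monoʳ-≤ 1 (∑-≥-length f ys pos-ys))))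
             (pos y (here refl))
    go : x ∈ y ∷ ys → f x ≡ 1
    go (here refl) = fy≡1
    go (there x∈)  = ∑≡length⇒≡1 f ys pos-ys
                       (+-cancelˡ-≡ 1 _ _ (trans (cong (_+ ∑ f ys) (sym fy≡1)) sum≡)) x x∈

module _ {A B : Set} where

  ∑-map : ∀ (f : B → ℕ) (g : A → B) xs → ∑ f (map g xs) ≡ ∑ (λ x → f (g x)) xs
  ∑-map f g []       = refl
  ∑-map f g (x ∷ xs) = cong (f (g x) +_) (∑-map f g xs)

  ∑-comm : ∀ (f : A → B → ℕ) xs ys →
           ∑ (λ x → ∑ (f x) ys) xs ≡ ∑ (λ y → ∑ (λ x → f x y) xs) ys
  ∑-comm f []       ys = sym (∑-zero _ ys (λ _ _ → refl))
  ∑-comm f (x ∷ xs) ys = trans (cong (∑ (f x) ys +_) (∑-comm f xs ys))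
                                (sym (∑-+ (f x) (λ y → ∑ (λ x′ → f x′ y) xs) ys))

∑-cartesianProductWith : ∀ {A B C : Set} (f : C → ℕ) (g : A → B → C) xs ys →
                         ∑ f (cartesianProductWith g xs ys) ≡ ∑ (λ x → ∑ (λ y → f (g x y)) ys) xs
∑-cartesianProductWith f g []       ys = refl
∑-cartesianProductWith f g (x ∷ xs) ys = trans (∑-++ f (map (g x) ys) _)
  (cong₂ _+_ (∑-map f (g x) ys) (∑-cartesianProductWith f g xs ys))

∑-applyUpTo : ∀ {A : Set} (f : A → ℕ) (g : ℕ → A) n →
              ∑ f (applyUpTo g n) ≡ ∑ (λ i → f (g i)) (upTo n)
∑-applyUpTo f g zero    = refl
∑-applyUpTo f g (suc n) = cong (f (g 0) +_) (trans (∑-applyUpTo f (λ i → g (suc i)) n)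
                                              (sym (∑-applyUpTo (λ i → f (g i)) suc n)))

∑-pairs : ∀ {A : Set} (g : A → A → ℕ) → (∀ x y → g x y ≡ g y x) → ∀ xs →
          2 * ∑ (λ (x , y) → g x y) (pairs xs) + ∑ (λ x → g x x) xs ≡ ∑ (λ x → ∑ (g x) xs) xs
∑-pairs g g-sym []       = refl
∑-pairs g g-sym (x ∷ xs) = begin
    2 * ∑ g′ (map (x ,_) xs ++ pairs xs) + (g x x + ∑ (λ z → g z z) xs)
  ≡⟨ cong (λ t → 2 * t + (g x x + ∑ (λ z → g z z) xs))
          (trans (∑-++ g′ (map (x ,_) xs) (pairs xs)) (cong (_+ ∑ g′ (pairs xs)) (∑-map g′ (x ,_) xs))) ⟩
    2 * (∑ (g x) xs + ∑ g′ (pairs xs)) + (g x x + ∑ (λ z → g z z) xs)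
  ≡⟨ rearrange (g x x) (∑ (g x) xs) (∑ g′ (pairs xs)) (∑ (λ z → g z z) xs) ⟩
    g x x + ∑ (g x) xs + (∑ (g x) xs + (2 * ∑ g′ (pairs xs) + ∑ (λ z → g z z) xs))
  ≡⟨ cong₂ (λ s t → g x x + ∑ (g x) xs + (s + t))
           (∑-ext xs (λ y → g-sym x y)) (∑-pairs g g-sym xs) ⟩
    g x x + ∑ (g x) xs + (∑ (λ z → g z x) xs + ∑ (λ z → ∑ (g z) xs) xs)
  ≡⟨ cong (g x x + ∑ (g x) xs +_) (sym (∑-+ (λ z → g z x) (λ z → ∑ (g z) xs) xs)) ⟩
    g x x + ∑ (g x) xs + ∑ (λ z → ∑ (g z) (x ∷ xs)) xs
  ∎
  where
  open ≡-Reasoning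
  g′ = λ (p : _ × _) → g (proj₁ p) (proj₂ p)
  rearrange : ∀ a s p d → 2 * (s + p) + (a + d) ≡ a + s + (s + (2 * p + d))
  rearrange = solve-∀

module _ {A : Set} (_≟_ : DecidableEquality A) where

  private
    ∑-select-∉ : ∀ (g : A → ℕ) x ys → x ∉ ys → ∑ (λ y → 𝟙 (x ≟ y) * g y) ys ≡ 0
    ∑-select-∉ g x []       _   = refl
    ∑-select-∉ g x (z ∷ zs) x∉ with x ≟ z
    ... | yes x≡z = ⊥-elim (x∉ (here x≡z))
    ... | no _    = ∑-select-∉ g x zs (λ x∈ → x∉ (there x∈))

    𝟙-≟-sym : ∀ x y → 𝟙 (x ≟ y) ≡ 𝟙 (y ≟ x)
    𝟙-≟-sym x y = 𝟙-cong sym sym (x ≟ y) (y ≟ x)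

  ∑-select : ∀ (g : A → ℕ) x ys → Unique ys → x ∈ ys → ∑ (λ y → 𝟙 (x ≟ y) * g y) ys ≡ g x
  ∑-select g x (z ∷ zs) (x∉zs ∷ _) (here refl) with x ≟ x
  ... | no x≢x = ⊥-elim (x≢x refl)
  ... | yes _  = trans (cong (g x + 0 +_) (∑-select-∉ g x zs (λ x∈ → All.lookup x∉zs x∈ refl)))
                       (trans (+-identityʳ _) (+-identityʳ _))
  ∑-select g x (z ∷ zs) (z∉zs ∷ u) (there x∈) with x ≟ z
  ... | yes refl = ⊥-elim (All.lookup z∉zs x∈ refl)
  ... | no _     = ∑-select g x zs u x∈

  ∑-reindex : ∀ (f : A → ℕ) xs ys → Unique xs → Unique ys → (∀ y → y ∈ ys → y ∈ xs) →
              (∀ x → x ∈ xs → x ∉ ys → f x ≡ 0) → ∑ f xs ≡ ∑ f ys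
  ∑-reindex f xs ys uxs uys ys⊆xs f≡0 = begin
      ∑ f xs
    ≡⟨ ∑-cong xs expand ⟩
      ∑ (λ x → ∑ (λ y → 𝟙 (x ≟ y) * f y) ys) xs
    ≡⟨ ∑-comm (λ x y → 𝟙 (x ≟ y) * f y) xs ys ⟩
      ∑ (λ y → ∑ (λ x → 𝟙 (x ≟ y) * f y) xs) ys
    ≡⟨ ∑-cong ys collapse ⟩
      ∑ f ys
    ∎
    where
    open ≡-Reasoning
    expand : ∀ x → x ∈ xs → f x ≡ ∑ (λ y → 𝟙 (x ≟ y) * f y) ys
    expand x x∈xs with _∈?_ _≟_ x ys
    ... | yes x∈ys = sym (∑-select f x ys uys x∈ys)
    ... | no x∉ys  = trans (f≡0 x x∈xs x∉ys) (sym (∑-select-∉ f x ys x∉ys))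
    collapse : ∀ y → y ∈ ys → ∑ (λ x → 𝟙 (x ≟ y) * f y) xs ≡ f y
    collapse y y∈ = trans (∑-ext xs (λ x → cong (_* f y) (𝟙-≟-sym x y)))
                          (∑-select (λ _ → f y) y xs uxs (ys⊆xs y y∈))

∑𝟙≡suc⇒∃ : ∀ {A : Set} {P : Pred A _} (P? : Decidable P) xs {n} → ∑ (λ x → 𝟙 (P? x)) xs ≡ suc n → ∃ P
∑𝟙≡suc⇒∃ P? (x ∷ xs) sum≡ with P? x
... | yes px = x , px
... | no _   = ∑𝟙≡suc⇒∃ P? xs sum≡

iter-+ : ∀ {A : Set} (s : A → A) a b p → iter (a + b) s p ≡ iter a s (iter b s p)
iter-+ s zero    b p = refl
iter-+ s (suc a) b p = cong s (iter-+ s a b p)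

%-≡-mod : ∀ m n .{{_ : NonZero n}} → (m % n) ≡ m [mod n ]
%-≡-mod m n = m / n , inj₂ (m≡m%n+[m/n]*n m n)

module RegularCyclic {A : Set} (s : A → A) (N : ℕ) .{{_ : NonZero N}}
  (period : ∀ p → iter N s p ≡ p)
  (free   : ∀ p i → 0 < i → i < N → iter i s p ≢ p)
  (transitive : ∀ p p′ → ∃ λ i → iter i s p ≡ p′) where

  iter-*N : ∀ k p → iter (k * N) s p ≡ p
  iter-*N zero    p = refl
  iter-*N (suc k) p = trans (iter-+ s N (k * N) p) (trans (cong (iter N s) (iter-*N k p)) (period p))

  iter-% : ∀ a p → iter a s p ≡ iter (a % N) s p
  iter-% a p = begin
      iter a s p                                 ≡⟨ cong (λ x → iter x s p) (m≡m%n+[m/n]*n a N) ⟩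
      iter (a % N + a / N * N) s p               ≡⟨ iter-+ s (a % N) (a / N * N) p ⟩
      iter (a % N) s (iter (a / N * N) s p)      ≡⟨ cong (iter (a % N) s) (iter-*N (a / N) p) ⟩
      iter (a % N) s p                           ∎
    where open ≡-Reasoning

  iter-≢ : ∀ {a b} p → a < b → b < N → iter a s p ≢ iter b s p
  iter-≢ {a} {b} p a<b b<N eq =
    free (iter a s p) (b ∸ a) (m<n⇒0<n∸m a<b) (≤-<-trans (m∸n≤m b a) b<N) (begin
      iter (b ∸ a) s (iter a s p)   ≡⟨ iter-+ s (b ∸ a) a p ⟨
      iter (b ∸ a + a) s p          ≡⟨ cong (λ x → iter x s p) (m∸n+n≡m (<⇒≤ a<b)) ⟩
      iter b s p                    ≡⟨ eq ⟨
      iter a s p                    ∎)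
    where open ≡-Reasoning

  iter-injective : ∀ {a b} p → a < N → b < N → iter a s p ≡ iter b s p → a ≡ b
  iter-injective {a} {b} p a<N b<N eq with <-cmp a b
  ... | tri< a<b _ _ = ⊥-elim (iter-≢ p a<b b<N eq)
  ... | tri≈ _ a≡b _ = a≡b
  ... | tri> _ _ b<a = ⊥-elim (iter-≢ p b<a a<N (sym eq))

  iter-≡⇒%-≡ : ∀ a b p → iter a s p ≡ iter b s p → a % N ≡ b % N
  iter-≡⇒%-≡ a b p eq = iter-injective p (m%n<n a N) (m%n<n b N)
    (trans (sym (iter-% a p)) (trans eq (iter-% b p)))

  %-≡⇒iter-≡ : ∀ a b p → a % N ≡ b % N → iter a s p ≡ iter b s p
  %-≡⇒iter-≡ a b p eq = trans (iter-% a p) (trans (cong (λ x → iter x s p) eq) (sym (iter-% b p)))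

  log : A → A → ℕ
  log x y = proj₁ (transitive x y) % N

  log<N : ∀ x y → log x y < N
  log<N x y = m%n<n (proj₁ (transitive x y)) N

  iter-log : ∀ x y → iter (log x y) s x ≡ y
  iter-log x y = trans (sym (iter-% (proj₁ (transitive x y)) x)) (proj₂ (transitive x y))

  log-unique : ∀ {a} x y → a < N → iter a s x ≡ y → log x y ≡ a
  log-unique x y a<N eq = iter-injective x (log<N x y) a<N (trans (iter-log x y) (sym eq))

  orbit : A → List A
  orbit x = applyUpTo (λ a → iter a s x) N

  orbit-unique : ∀ x → Unique (orbit x)
  orbit-unique x = Unique.applyUpTo⁺₁ _ N (λ i<j j<N → iter-≢ x i<j j<N)

  ∈-orbit : ∀ x y → y ∈ orbit x
  ∈-orbit x y = subst (_∈ orbit x) (iter-log x y) (∈-applyUpTo⁺ (λ a → iter a s x) (log<N x y))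

module Imprimitive {A : Set} (s : A → A) (c d : ℕ) .{{_ : NonZero c}} .{{_ : NonZero d}}
  (period : ∀ p → iter (c * d) s p ≡ p)
  (free   : ∀ p i → 0 < i → i < c * d → iter i s p ≢ p)
  (transitive : ∀ p p′ → ∃ λ i → iter i s p ≡ p′) where

  instance
    c*d≢0 : NonZero (c * d)
    c*d≢0 = m*n≢0 c d

  private
    %[c*d]%d : ∀ a → a % (c * d) % d ≡ a % d
    %[c*d]%d a = m∣n⇒o%n%m≡o%m d (c * d) a (divides c refl)

  open RegularCyclic s (c * d) period free transitive public

  -- SameClass, StabClass, HOrbit and KOrbit are the notions of PG.Classes, for any set acted on by s.
  SameClass : A → A → Set
  SameClass x y = Any (λ j → iter (d * j) s x ≡ y) (upTo c)

  class : A → List A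
  class x = applyUpTo (λ j → iter (d * j) s x) c

  class-unique : ∀ x → Unique (class x)
  class-unique x = Unique.applyUpTo⁺₁ _ c (λ {i} {j} i<j j<c → iter-≢ x
    (*-monoʳ-< d i<j) (subst (d * j <_) (*-comm d c) (*-monoʳ-< d j<c)))

  SameClass⇒∈class : ∀ {x y} → SameClass x y → y ∈ class x
  SameClass⇒∈class {x} x~y with j , j<c , eq ← applyUpTo⁻ (λ j → j) x~y =
    subst (_∈ class x) eq (∈-applyUpTo⁺ (λ j → iter (d * j) s x) j<c)

  ∈class⇒SameClass : ∀ {x y} → y ∈ class x → SameClass x y
  ∈class⇒SameClass {x} y∈ with j , j<c , eq ← ∈-applyUpTo⁻ (λ j → iter (d * j) s x) y∈ =
    applyUpTo⁺ (λ j → j) (sym eq) j<c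

  SameClass-by : ∀ {x y} j → iter (d * j) s x ≡ y → SameClass x y
  SameClass-by {x} j eq = applyUpTo⁺ (λ j → j) (trans (%-≡⇒iter-≡ _ _ x reduce) eq) (m%n<n j c)
    where
    reduce : d * (j % c) % (c * d) ≡ d * j % (c * d)
    reduce = begin
        d * (j % c) % (c * d)                          ≡⟨ [m+kn]%n≡m%n (d * (j % c)) (j / c) (c * d) ⟨
        (d * (j % c) + j / c * (c * d)) % (c * d)      ≡⟨ cong (_% (c * d)) (regroup d (j % c) (j / c) c) ⟩
        d * (j % c + j / c * c) % (c * d)              ≡⟨ cong (λ t → d * t % (c * d)) (m≡m%n+[m/n]*n j c) ⟨
        d * j % (c * d)                                ∎
      where
      open ≡-Reasoning
      regroup : ∀ d r k c → d * r + k * (c * d) ≡ d * (r + k * c)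
      regroup = solve-∀

  SameClass-refl : ∀ x → SameClass x x
  SameClass-refl x = SameClass-by 0 (cong (λ t → iter t s x) (*-zeroʳ d))

  SameClass⇒%d : ∀ a b x → SameClass (iter a s x) (iter b s x) → a % d ≡ b % d
  SameClass⇒%d a b x x~y with j , _ , eq ← applyUpTo⁻ (λ j → j) x~y = begin
      a % d                          ≡⟨ [m+kn]%n≡m%n a j d ⟨
      (a + j * d) % d                ≡⟨ cong (λ t → (a + t) % d) (*-comm j d) ⟩
      (a + d * j) % d                ≡⟨ cong (_% d) (+-comm a (d * j)) ⟩
      (d * j + a) % d                ≡⟨ %[c*d]%d (d * j + a) ⟨
      (d * j + a) % (c * d) % d      ≡⟨ cong (_% d) (iter-≡⇒%-≡ _ _ x (trans (iter-+ s (d * j) a x) eq)) ⟩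
      b % (c * d) % d                ≡⟨ %[c*d]%d b ⟩
      b % d                          ∎
    where open ≡-Reasoning

  %d⇒SameClass : ∀ a b x → a % d ≡ b % d → SameClass (iter a s x) (iter b s x)
  %d⇒SameClass a b x eq = SameClass-by j (begin
      iter (d * j) s (iter a s x)           ≡⟨ iter-+ s (d * j) a x ⟨
      iter (d * j + a) s x                  ≡⟨ cong (λ t → iter t s x) exponent ⟩
      iter (b + a / d * (c * d)) s x        ≡⟨ iter-+ s b _ x ⟩
      iter b s (iter (a / d * (c * d)) s x) ≡⟨ cong (iter b s) (iter-*N (a / d) x) ⟩
      iter b s x                            ∎)
    where
    open ≡-Reasoning
    j = b / d + pred c * (a / d)
    regroup : ∀ d r u v c′ → d * (v + c′ * u) + (r + u * d) ≡ r + v * d + u * (suc c′ * d)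
    regroup = solve-∀
    exponent : d * j + a ≡ b + a / d * (c * d)
    exponent = begin
        d * j + a                                      ≡⟨ cong (d * j +_) (m≡m%n+[m/n]*n a d) ⟩
        d * j + (a % d + a / d * d)                    ≡⟨ regroup d (a % d) (a / d) (b / d) (pred c) ⟩
        a % d + b / d * d + a / d * (suc (pred c) * d) ≡⟨ cong₂ (λ r c′ → r + b / d * d + a / d * (c′ * d)) eq (suc-pred c) ⟩
        b % d + b / d * d + a / d * (c * d)            ≡⟨ cong (_+ a / d * (c * d)) (m≡m%n+[m/n]*n b d) ⟨
        b + a / d * (c * d)                            ∎

  SameClass-sym : ∀ {x y} → SameClass x y → SameClass y x
  SameClass-sym {x} {y} x~y = subst (λ z → SameClass z x) (iter-log x y)
    (%d⇒SameClass (log x y) 0 x (sym (SameClass⇒%d 0 (log x y) x (subst (SameClass x) (sym (iter-log x y)) x~y))))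

  StabClass : A → ℕ → Set
  StabClass x i = ∀ p → SameClass x p → SameClass x (iter i s p)

  HOrbit : A → A → A → Set
  HOrbit x y z = ∃ λ i → StabClass x i × iter i s x ≡ x × iter i s y ≡ z

  KOrbit : A → A → A → Set
  KOrbit x y z = ∃ λ i → StabClass x i × SameClass (iter i s y) z

  -- G is abelian and regular, so the stabiliser of x in H is trivial.
  HOrbit⇒≡ : ∀ {x y z} → HOrbit x y z → y ≡ z
  HOrbit⇒≡ {x} {y} (i , _ , ix≡x , iy≡z) = trans (sym (%-≡⇒iter-≡ i 0 y (iter-≡⇒%-≡ i 0 x ix≡x))) iy≡z

  rankH : ∀ x → HasOrbitCount (SameClass x) (HOrbit x) c
  rankH x = class x , length-applyUpTo _ c
          , All.tabulate ∈class⇒SameClass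
          , AllPairs.map (λ y≢z → y≢z ∘′ HOrbit⇒≡) (class-unique x)
          , λ y x~y → Any.map (λ eq → 0 , (λ _ h → h) , refl , sym eq) (SameClass⇒∈class x~y)

  StabClass⇒%d : ∀ {x i} → StabClass x i → i % d ≡ 0
  StabClass⇒%d {x} {i} stab = trans (sym (SameClass⇒%d 0 i x (stab x (SameClass-refl x)))) (m<n⇒m%n≡m (>-nonZero⁻¹ d))

  rankK : ∀ x → HasOrbitCount (λ _ → ⊤) (KOrbit x) d
  rankK x = applyUpTo (λ r → iter r s x) d , length-applyUpTo _ d , All.tabulate (λ _ → tt)
          , AllPairs.applyUpTo⁺₁ _ d separated
          , λ y _ → applyUpTo⁺ (λ r → iter r s x) (0 , (λ _ h → h) , represents y) (m%n<n (log x y) d)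
    where
    separated : ∀ {r r′} → r < r′ → r′ < d → ¬ KOrbit x (iter r s x) (iter r′ s x)
    separated {r} {r′} r<r′ r′<d (i , stab , i+r~r′) = <⇒≢ r<r′ (begin
        r                 ≡⟨ m<n⇒m%n≡m (<-trans r<r′ r′<d) ⟨
        r % d             ≡⟨ m%n%n≡m%n r d ⟨
        (0 + r % d) % d   ≡⟨ cong (λ t → (t + r % d) % d) (StabClass⇒%d stab) ⟨
        (i % d + r % d) % d ≡⟨ %-distribˡ-+ i r d ⟨
        (i + r) % d       ≡⟨ SameClass⇒%d (i + r) r′ x (subst (λ z → SameClass z (iter r′ s x)) (sym (iter-+ s i r x)) i+r~r′) ⟩
        r′ % d            ≡⟨ m<n⇒m%n≡m r′<d ⟩
        r′                ∎)
      where open ≡-Reasoning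
    represents : ∀ y → SameClass (iter (log x y % d) s x) y
    represents y = subst (SameClass _) (iter-log x y) (%d⇒SameClass _ (log x y) x (m%n%n≡m%n (log x y) d))

  -- p ↦ (class-internal index, class index), read off the logarithm to base p₀ in base d
  module Coordinates (p₀ : A) where

    coord : A → Fin c × Fin d
    coord p = fromℕ< (m<n*o⇒m/o<n (log<N p₀ p)) , fromℕ< (m%n<n (log p₀ p) d)

    point : Fin c × Fin d → A
    point (u , r) = iter (toℕ r + toℕ u * d) s p₀

    toℕ-coord₁ : ∀ p → toℕ (proj₁ (coord p)) ≡ log p₀ p / d
    toℕ-coord₁ p = toℕ-fromℕ< _

    toℕ-coord₂ : ∀ p → toℕ (proj₂ (coord p)) ≡ log p₀ p % d
    toℕ-coord₂ p = toℕ-fromℕ< _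

    log-point : ∀ u r → log p₀ (point (u , r)) ≡ toℕ r + toℕ u * d
    log-point u r = log-unique p₀ _ (≤-trans (+-monoˡ-< (toℕ u * d) (toℕ<n r)) (*-monoˡ-≤ d (toℕ<n u))) refl

    coord-point : ∀ x → coord (point x) ≡ x
    coord-point (u , r) = cong₂ _,_
      (toℕ-injective (begin
        toℕ (proj₁ (coord (point (u , r))))  ≡⟨ trans (toℕ-coord₁ _) (cong (_/ d) (log-point u r)) ⟩
        (toℕ r + toℕ u * d) / d              ≡⟨ +-distrib-/-∣ʳ (toℕ r) (divides (toℕ u) refl) ⟩
        toℕ r / d + toℕ u * d / d            ≡⟨ cong₂ _+_ (m<n⇒m/n≡0 (toℕ<n r)) (m*n/n≡m (toℕ u) d) ⟩
        toℕ u                                ∎))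
      (toℕ-injective (begin
        toℕ (proj₂ (coord (point (u , r))))  ≡⟨ trans (toℕ-coord₂ _) (cong (_% d) (log-point u r)) ⟩
        (toℕ r + toℕ u * d) % d              ≡⟨ [m+kn]%n≡m%n (toℕ r) (toℕ u) d ⟩
        toℕ r % d                            ≡⟨ m<n⇒m%n≡m (toℕ<n r) ⟩
        toℕ r                                ∎))
      where open ≡-Reasoning

    point-coord : ∀ p → point (coord p) ≡ p
    point-coord p = begin
        iter (toℕ (proj₂ (coord p)) + toℕ (proj₁ (coord p)) * d) s p₀ ≡⟨ cong₂ (λ r u → iter (r + u * d) s p₀) (toℕ-coord₂ p) (toℕ-coord₁ p) ⟩
        iter (log p₀ p % d + log p₀ p / d * d) s p₀                    ≡⟨ cong (λ t → iter t s p₀) (m≡m%n+[m/n]*n (log p₀ p) d) ⟨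
        iter (log p₀ p) s p₀                                           ≡⟨ iter-log p₀ p ⟩
        p                                                              ∎
      where open ≡-Reasoning

    coordinates : A ↔ (Fin c × Fin d)
    coordinates = mk↔ₛ′ coord point coord-point point-coord

    SameClass⇔coord₂ : ∀ p p′ → SameClass p p′ ⇔ (proj₂ (coord p) ≡ proj₂ (coord p′))
    SameClass⇔coord₂ p p′ = mk⇔
      (λ p~p′ → toℕ-injective (trans (toℕ-coord₂ p) (trans (SameClass⇒%d _ _ p₀
        (subst₂ SameClass (sym (iter-log p₀ p)) (sym (iter-log p₀ p′)) p~p′)) (sym (toℕ-coord₂ p′)))))
      (λ eq → subst₂ SameClass (iter-log p₀ p) (iter-log p₀ p′) (%d⇒SameClass _ _ p₀
        (trans (sym (toℕ-coord₂ p)) (trans (cong toℕ eq) (toℕ-coord₂ p′)))))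

    log-iter : ∀ i p → log p₀ (iter i s p) ≡ (i + log p₀ p) % (c * d)
    log-iter i p = log-unique p₀ _ (m%n<n (i + log p₀ p) (c * d)) (begin
      iter ((i + log p₀ p) % (c * d)) s p₀   ≡⟨ iter-% (i + log p₀ p) p₀ ⟨
      iter (i + log p₀ p) s p₀               ≡⟨ iter-+ s i (log p₀ p) p₀ ⟩
      iter i s (iter (log p₀ p) s p₀)        ≡⟨ cong (iter i s) (iter-log p₀ p) ⟩
      iter i s p                             ∎)
      where open ≡-Reasoning

    private
      carry : ∀ i a → i + a ≡ (a % d + i) + a / d * d
      carry i a = trans (cong (i +_) (m≡m%n+[m/n]*n a d)) (rearrange i (a % d) (a / d * d))
        where
        rearrange : ∀ x y z → x + (y + z) ≡ (y + x) + z
        rearrange = solve-∀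

    toℕ-coord₂-iter : ∀ i p → toℕ (proj₂ (coord (iter i s p))) ≡ (log p₀ p % d + i) % d
    toℕ-coord₂-iter i p = begin
      toℕ (proj₂ (coord (iter i s p)))   ≡⟨ trans (toℕ-coord₂ _) (cong (_% d) (log-iter i p)) ⟩
      (i + a) % (c * d) % d              ≡⟨ %[c*d]%d (i + a) ⟩
      (i + a) % d                        ≡⟨ cong (_% d) (carry i a) ⟩
      (a % d + i + a / d * d) % d        ≡⟨ [m+kn]%n≡m%n (a % d + i) (a / d) d ⟩
      (a % d + i) % d                    ∎
      where
      open ≡-Reasoning
      a = log p₀ p

    toℕ-coord₁-iter : ∀ i p → toℕ (proj₁ (coord (iter i s p))) ≡ (log p₀ p / d + (log p₀ p % d + i) / d) % c
    toℕ-coord₁-iter i p = begin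
      toℕ (proj₁ (coord (iter i s p)))     ≡⟨ trans (toℕ-coord₁ _) (cong (_/ d) (log-iter i p)) ⟩
      (i + a) % (c * d) / d                 ≡⟨ m%[n*o]/o≡m/o%n (i + a) c d ⟩
      (i + a) / d % c                       ≡⟨ cong (λ t → t / d % c) (carry i a) ⟩
      (a % d + i + a / d * d) / d % c       ≡⟨ cong (_% c) (+-distrib-/-∣ʳ (a % d + i) (divides (a / d) refl)) ⟩
      ((a % d + i) / d + a / d * d / d) % c ≡⟨ cong (λ t → ((a % d + i) / d + t) % c) (m*n/n≡m (a / d) d) ⟩
      ((a % d + i) / d + a / d) % c         ≡⟨ cong (_% c) (+-comm _ (a / d)) ⟩
      (a / d + (a % d + i) / d) % c         ∎
      where
      open ≡-Reasoning
      a = log p₀ p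

    -- base-d addition of i, whose carry into the inner index depends only on the class index
    coord-iter : ∀ i → ∃ λ (t : ℕ) → ∃ λ (f : Fin d → ℕ) → ∀ p →
                   (toℕ (proj₂ (coord (iter i s p))) ≡ toℕ (proj₂ (coord p)) + t [mod d ])
                 × (toℕ (proj₁ (coord (iter i s p))) ≡ toℕ (proj₁ (coord p)) + f (proj₂ (coord p)) [mod c ])
    coord-iter i = i , (λ r → (toℕ r + i) / d) , λ p →
        subst₂ _≡_[mod d ] (sym (toℕ-coord₂-iter i p)) (cong (_+ i) (sym (toℕ-coord₂ p))) (%-≡-mod _ d)
      , subst₂ _≡_[mod c ] (sym (toℕ-coord₁-iter i p))
                            (cong₂ (λ u r → u + (r + i) / d) (sym (toℕ-coord₁ p)) (sym (toℕ-coord₂ p))) (%-≡-mod _ c)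

module IncidenceCounts {P L : Set} (_≟_ : DecidableEquality P)
  (_I_ : P → L → Set) (_I?_ : ∀ p ℓ → Dec (p I ℓ))
  (points : List P) (points-unique : Unique points) (∈-points : ∀ p → p ∈ points)
  (q : ℕ) (line-size : ∀ ℓ → ∑ (λ p → 𝟙 (p I? ℓ)) points ≡ suc q)
  (lines-meet : ∀ ℓ ℓ′ → ∃ λ p → p I ℓ × p I ℓ′) where

  module DifferenceSet (s : P → P) (N : ℕ) .{{_ : NonZero N}} (N≡ : q * q + q + 1 ≡ N)
    (period : ∀ p → iter N s p ≡ p)
    (free   : ∀ p i → 0 < i → i < N → iter i s p ≢ p)
    (transitive : ∀ p p′ → ∃ λ i → iter i s p ≡ p′)
    (collineation : ∀ ℓ → ∃ λ ℓ′ → ∀ p → (p I ℓ → s p I ℓ′) × (s p I ℓ′ → p I ℓ)) where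

    open RegularCyclic s N period free transitive

    meets : L → ℕ → ℕ
    meets ℓ a = ∑ (λ x → 𝟙 (x I? ℓ) * 𝟙 (iter a s x I? ℓ)) points

    private
      pull-back : ∀ b ℓ → ∃ λ ℓ′ → ∀ p → iter b s p I ℓ′ → p I ℓ
      pull-back zero    ℓ = ℓ , λ p p∈ → p∈
      pull-back (suc b) ℓ with ℓ₁ , back₁ ← pull-back b ℓ with ℓ₂ , img ← collineation ℓ₁ =
        ℓ₂ , λ p p∈ → back₁ p (proj₂ (img (iter b s p)) p∈)

    -- pull ℓ back along s^(N - a % N), the inverse of s^a
    pre-image : ∀ a ℓ → ∃ λ ℓ′ → ∀ x → x I ℓ′ → iter a s x I ℓ
    pre-image a ℓ with ℓ′ , back ← pull-back (N ∸ a % N) ℓ =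
      ℓ′ , λ x x∈ → back (iter a s x) (subst (_I ℓ′) (sym (round-trip x)) x∈)
      where
      exponent : N ∸ a % N + a ≡ suc (a / N) * N
      exponent = begin
        N ∸ a % N + a                      ≡⟨ cong (N ∸ a % N +_) (m≡m%n+[m/n]*n a N) ⟩
        N ∸ a % N + (a % N + a / N * N)    ≡⟨ +-assoc (N ∸ a % N) (a % N) _ ⟨
        N ∸ a % N + a % N + a / N * N      ≡⟨ cong (_+ a / N * N) (m∸n+n≡m (<⇒≤ (m%n<n a N))) ⟩
        suc (a / N) * N                    ∎
        where open ≡-Reasoning
      round-trip : ∀ x → iter (N ∸ a % N) s (iter a s x) ≡ x
      round-trip x = trans (sym (iter-+ s (N ∸ a % N) a x))
                           (trans (cong (λ t → iter t s x) exponent) (iter-*N (suc (a / N)) x))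

    meets-0 : ∀ ℓ → meets ℓ 0 ≡ suc q
    meets-0 ℓ = trans (∑-ext points (λ x → 𝟙-idem (x I? ℓ))) (line-size ℓ)

    meets-pos : ∀ ℓ a → 1 ≤ meets ℓ a
    meets-pos ℓ a with ℓ′ , into ← pre-image a ℓ with x , x∈ℓ , x∈ℓ′ ← lines-meet ℓ ℓ′ =
      ≤-trans (≤-reflexive (sym (cong₂ _*_ (𝟙-yes (x I? ℓ) x∈ℓ) (𝟙-yes (iter a s x I? ℓ) (into x x∈ℓ′)))))
              (∑-≥-term (λ x → 𝟙 (x I? ℓ) * 𝟙 (iter a s x I? ℓ)) (∈-points x))

    M : ℕ
    M = q * suc q

    N≡1+M : N ≡ suc M
    N≡1+M = trans (sym N≡) (shape q)
      where
      shape : ∀ q → q * q + q + 1 ≡ suc (q * suc q)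
      shape = solve-∀

    ∑-orbit : ∀ ℓ x → ∑ (λ a → 𝟙 (iter a s x I? ℓ)) (upTo N) ≡ suc q
    ∑-orbit ℓ x = begin
      ∑ (λ a → 𝟙 (iter a s x I? ℓ)) (upTo N)   ≡⟨ ∑-applyUpTo (λ p → 𝟙 (p I? ℓ)) (λ a → iter a s x) N ⟨
      ∑ (λ p → 𝟙 (p I? ℓ)) (orbit x)           ≡⟨ ∑-reindex _≟_ _ points (orbit x) points-unique (orbit-unique x)
                                                     (λ y _ → ∈-points y) (λ y _ y∉ → ⊥-elim (y∉ (∈-orbit x y))) ⟨
      ∑ (λ p → 𝟙 (p I? ℓ)) points              ≡⟨ line-size ℓ ⟩
      suc q                                    ∎
      where open ≡-Reasoning

    ∑-orbit-rest : ∀ ℓ x → x I ℓ → ∑ (λ a → 𝟙 (iter (suc a) s x I? ℓ)) (upTo M) ≡ q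
    ∑-orbit-rest ℓ x x∈ = suc-injective (begin
      suc (∑ (λ a → 𝟙 (iter (suc a) s x I? ℓ)) (upTo M))
        ≡⟨ cong (_+ ∑ (λ a → 𝟙 (iter (suc a) s x I? ℓ)) (upTo M)) (𝟙-yes (x I? ℓ) x∈) ⟨
      𝟙 (x I? ℓ) + ∑ (λ a → 𝟙 (iter (suc a) s x I? ℓ)) (upTo M)
        ≡⟨ cong (𝟙 (x I? ℓ) +_) (∑-applyUpTo (λ a → 𝟙 (iter a s x I? ℓ)) suc M) ⟨
      ∑ (λ a → 𝟙 (iter a s x I? ℓ)) (upTo (suc M))
        ≡⟨ subst (λ n → ∑ (λ a → 𝟙 (iter a s x I? ℓ)) (upTo n) ≡ suc q) N≡1+M (∑-orbit ℓ x) ⟩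
      suc q ∎)
      where open ≡-Reasoning

    ∑-meets : ∀ ℓ → ∑ (meets ℓ) (applyUpTo suc M) ≡ length (applyUpTo suc M)
    ∑-meets ℓ = begin
      ∑ (meets ℓ) (applyUpTo suc M)
        ≡⟨ ∑-applyUpTo (meets ℓ) suc M ⟩
      ∑ (λ a → ∑ (λ x → on x * on (iter (suc a) s x)) points) (upTo M)
        ≡⟨ ∑-comm (λ x a → on x * on (iter (suc a) s x)) points (upTo M) ⟨
      ∑ (λ x → ∑ (λ a → on x * on (iter (suc a) s x)) (upTo M)) points
        ≡⟨ ∑-ext points (λ x → trans (∑-*ˡ (on x) _ (upTo M)) (rest x)) ⟩
      ∑ (λ x → q * on x) points
        ≡⟨ trans (∑-*ˡ q on points) (cong (q *_) (line-size ℓ)) ⟩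
      M
        ≡⟨ length-applyUpTo suc M ⟨
      length (applyUpTo suc M) ∎
      where
      open ≡-Reasoning
      on : P → ℕ
      on x = 𝟙 (x I? ℓ)
      rest : ∀ x → on x * ∑ (λ a → on (iter (suc a) s x)) (upTo M) ≡ q * on x
      rest x with x I? ℓ
      ... | yes x∈ = trans (+-identityʳ _) (trans (∑-orbit-rest ℓ x x∈) (sym (*-identityʳ q)))
      ... | no _   = sym (*-zeroʳ q)

    meets-≡1 : ∀ ℓ a → 0 < a → a < N → meets ℓ a ≡ 1
    meets-≡1 ℓ (suc a) _ a<N = ∑≡length⇒≡1 (meets ℓ) (applyUpTo suc M) (λ b _ → meets-pos ℓ b)
      (∑-meets ℓ) (suc a) (∈-applyUpTo⁺ suc (≤-pred (subst (suc a <_) N≡1+M a<N)))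

  module ClassPairs (s : P → P) (c d : ℕ) .{{_ : NonZero c}} .{{_ : NonZero d}}
    (N≡ : q * q + q + 1 ≡ c * d)
    (period : ∀ p → iter (c * d) s p ≡ p)
    (free   : ∀ p i → 0 < i → i < c * d → iter i s p ≢ p)
    (transitive : ∀ p p′ → ∃ λ i → iter i s p ≡ p′)
    (collineation : ∀ ℓ → ∃ λ ℓ′ → ∀ p → (p I ℓ → s p I ℓ′) × (s p I ℓ′ → p I ℓ)) where

    open Imprimitive s c d period free transitive
    open DifferenceSet s (c * d) N≡ period free transitive collineation using (meets; meets-0; meets-≡1)

    -- sameClass?, samePairs and diffPairs are those of PG.Classes, for an abstract incidence structure.
    sameClass? : ∀ p p′ → Dec (SameClass p p′)
    sameClass? p p′ = any? (λ j → iter (d * j) s p ≟ p′) (upTo c)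

    samePairs : L → ℕ
    samePairs ℓ = length (filter
      (λ pp → (proj₁ pp I? ℓ) ×-dec (proj₂ pp I? ℓ) ×-dec sameClass? (proj₁ pp) (proj₂ pp))
      (pairs points))

    diffPairs : L → ℕ
    diffPairs ℓ = length (filter
      (λ pp → (proj₁ pp I? ℓ) ×-dec (proj₂ pp I? ℓ) ×-dec ¬? (sameClass? (proj₁ pp) (proj₂ pp)))
      (pairs points))

    module _ (ℓ : L) where

      on : P → ℕ
      on x = 𝟙 (x I? ℓ)

      same : P → P → ℕ
      same x y = 𝟙 ((x I? ℓ) ×-dec (y I? ℓ) ×-dec sameClass? x y)

      diff : P → P → ℕ
      diff x y = 𝟙 ((x I? ℓ) ×-dec (y I? ℓ) ×-dec ¬? (sameClass? x y))

      same-sym : ∀ x y → same x y ≡ same y x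
      same-sym x y = 𝟙-cong swap swap _ _
        where
        swap : ∀ {x y} → x I ℓ × y I ℓ × SameClass x y → y I ℓ × x I ℓ × SameClass y x
        swap (x∈ , y∈ , x~y) = y∈ , x∈ , SameClass-sym x~y

      same-split : ∀ x y → same x y ≡ on x * (on y * 𝟙 (sameClass? x y))
      same-split x y = trans (𝟙-× (x I? ℓ) _) (cong (on x *_) (𝟙-× (y I? ℓ) _))

      same+diff : ∀ x y → same x y + diff x y ≡ on x * on y
      same+diff x y = begin
        same x y + diff x y
          ≡⟨ cong₂ _+_ (same-split x y) (trans (𝟙-× (x I? ℓ) _) (cong (on x *_) (𝟙-× (y I? ℓ) _))) ⟩
        on x * (on y * 𝟙 (sameClass? x y)) + on x * (on y * 𝟙 (¬? (sameClass? x y)))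
          ≡⟨ factor (on x) (on y) _ _ ⟩
        on x * on y * (𝟙 (sameClass? x y) + 𝟙 (¬? (sameClass? x y)))
          ≡⟨ trans (cong (on x * on y *_) (𝟙-¬ (sameClass? x y))) (*-identityʳ _) ⟩
        on x * on y ∎
        where
        open ≡-Reasoning
        factor : ∀ a b e e′ → a * (b * e) + a * (b * e′) ≡ a * b * (e + e′)
        factor = solve-∀

      ∑-class : ∀ x → ∑ (λ y → on y * 𝟙 (sameClass? x y)) points ≡ ∑ (λ j → on (iter (d * j) s x)) (upTo c)
      ∑-class x = begin
        ∑ (λ y → on y * 𝟙 (sameClass? x y)) points
          ≡⟨ ∑-reindex _≟_ _ points (class x) points-unique (class-unique x) (λ y _ → ∈-points y) off-class ⟩
        ∑ (λ y → on y * 𝟙 (sameClass? x y)) (class x)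
          ≡⟨ ∑-cong (class x) (λ y y∈ → trans (cong (on y *_) (𝟙-yes (sameClass? x y) (∈class⇒SameClass y∈)))
                                                (*-identityʳ (on y))) ⟩
        ∑ on (class x)
          ≡⟨ ∑-applyUpTo on (λ j → iter (d * j) s x) c ⟩
        ∑ (λ j → on (iter (d * j) s x)) (upTo c) ∎
        where
        open ≡-Reasoning
        off-class : ∀ y → y ∈ points → ¬ y ∈ class x → on y * 𝟙 (sameClass? x y) ≡ 0
        off-class y _ y∉ = trans (cong (on y *_) (𝟙-no (sameClass? x y) (λ x~y → y∉ (SameClass⇒∈class x~y))))
                                 (*-zeroʳ (on y))

      ∑-meets-class : ∑ (λ j → meets ℓ (d * j)) (upTo c) ≡ q + c
      ∑-meets-class = subst (λ k → ∑ (λ j → meets ℓ (d * j)) (upTo k) ≡ q + k) (suc-pred c) (begin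
        meets ℓ (d * 0) + ∑ (λ j → meets ℓ (d * j)) (applyUpTo suc (pred c))
          ≡⟨ cong₂ _+_ (trans (cong (meets ℓ) (*-zeroʳ d)) (meets-0 ℓ)) (∑-applyUpTo _ suc (pred c)) ⟩
        suc q + ∑ (λ j → meets ℓ (d * suc j)) (upTo (pred c))
          ≡⟨ cong (suc q +_) (∑-cong (upTo (pred c)) (λ j j∈ → meets-≡1 ℓ (d * suc j)
               (>-nonZero⁻¹ (d * suc j) {{m*n≢0 d (suc j)}}) (shifted-< (∈-upTo⁻ j∈)))) ⟩
        suc q + ∑ (λ _ → 1) (upTo (pred c))
          ≡⟨ cong (suc q +_) (trans (∑-const 1 (upTo (pred c))) (trans (*-identityʳ _) (length-upTo (pred c)))) ⟩
        suc q + pred c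
          ≡⟨ +-suc q (pred c) ⟨
        q + suc (pred c) ∎)
        where
        open ≡-Reasoning
        shifted-< : ∀ {j} → j < pred c → d * suc j < c * d
        shifted-< {j} j< = subst (d * suc j <_) (*-comm d c) (*-monoʳ-< d (subst (suc (suc j) ≤_) (suc-pred c) (s≤s j<)))

      ∑∑-same : ∑ (λ x → ∑ (same x) points) points ≡ q + c
      ∑∑-same = begin
        ∑ (λ x → ∑ (same x) points) points
          ≡⟨ ∑-ext points (λ x → trans (∑-ext points (same-split x)) (∑-*ˡ (on x) _ points)) ⟩
        ∑ (λ x → on x * ∑ (λ y → on y * 𝟙 (sameClass? x y)) points) points
          ≡⟨ ∑-ext points (λ x → trans (cong (on x *_) (∑-class x)) (sym (∑-*ˡ (on x) _ (upTo c)))) ⟩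
        ∑ (λ x → ∑ (λ j → on x * on (iter (d * j) s x)) (upTo c)) points
          ≡⟨ ∑-comm (λ x j → on x * on (iter (d * j) s x)) points (upTo c) ⟩
        ∑ (λ j → meets ℓ (d * j)) (upTo c)
          ≡⟨ ∑-meets-class ⟩
        q + c ∎
        where open ≡-Reasoning

      ∑-on-diagonal : ∑ (λ x → on x * on x) points ≡ suc q
      ∑-on-diagonal = trans (∑-ext points (λ x → 𝟙-idem (x I? ℓ))) (line-size ℓ)

      ∑-same-diagonal : ∑ (λ x → same x x) points ≡ suc q
      ∑-same-diagonal = trans (∑-ext points (λ x → trans (same-split x x)
        (trans (cong (λ e → on x * (on x * e)) (𝟙-yes (sameClass? x x) (SameClass-refl x)))
               (cong (on x *_) (*-identityʳ (on x)))))) ∑-on-diagonal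

      samePairs-odd : 2 * samePairs ℓ + 1 ≡ c
      samePairs-odd = +-cancelʳ-≡ q _ _ (begin
        2 * samePairs ℓ + 1 + q                                   ≡⟨ +-assoc (2 * samePairs ℓ) 1 q ⟩
        2 * samePairs ℓ + suc q                                   ≡⟨ cong₂ (λ S D → 2 * S + D)
                                                                       (length-filter≡∑𝟙 _ (pairs points)) (sym ∑-same-diagonal) ⟩
        2 * ∑ (λ (x , y) → same x y) (pairs points) + ∑ (λ x → same x x) points ≡⟨ ∑-pairs same same-sym points ⟩
        ∑ (λ x → ∑ (same x) points) points                        ≡⟨ ∑∑-same ⟩
        q + c                                                     ≡⟨ +-comm q c ⟩
        c + q                                                     ∎)
        where open ≡-Reasoning

      pairs-on-line : 2 * (samePairs ℓ + diffPairs ℓ) + suc q ≡ suc q * suc q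
      pairs-on-line = begin
        2 * (samePairs ℓ + diffPairs ℓ) + suc q
          ≡⟨ cong₂ (λ S D → 2 * S + D) all-pairs (sym ∑-on-diagonal) ⟩
        2 * ∑ (λ (x , y) → on x * on y) (pairs points) + ∑ (λ x → on x * on x) points
          ≡⟨ ∑-pairs (λ x y → on x * on y) (λ x y → *-comm (on x) (on y)) points ⟩
        ∑ (λ x → ∑ (λ y → on x * on y) points) points
          ≡⟨ ∑-ext points (λ x → trans (∑-*ˡ (on x) on points) (cong (on x *_) (line-size ℓ))) ⟩
        ∑ (λ x → on x * suc q) points
          ≡⟨ trans (∑-ext points (λ x → *-comm (on x) (suc q))) (∑-*ˡ (suc q) on points) ⟩
        suc q * ∑ on points
          ≡⟨ cong (suc q *_) (line-size ℓ) ⟩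
        suc q * suc q ∎
        where
        open ≡-Reasoning
        all-pairs : samePairs ℓ + diffPairs ℓ ≡ ∑ (λ (x , y) → on x * on y) (pairs points)
        all-pairs = begin
          samePairs ℓ + diffPairs ℓ
            ≡⟨ cong₂ _+_ (length-filter≡∑𝟙 _ (pairs points)) (length-filter≡∑𝟙 _ (pairs points)) ⟩
          ∑ (λ (x , y) → same x y) (pairs points) + ∑ (λ (x , y) → diff x y) (pairs points)
            ≡⟨ ∑-+ (λ (x , y) → same x y) (λ (x , y) → diff x y) (pairs points) ⟨
          ∑ (λ (x , y) → same x y + diff x y) (pairs points)
            ≡⟨ ∑-ext (pairs points) (λ (x , y) → same+diff x y) ⟩
          ∑ (λ (x , y) → on x * on y) (pairs points) ∎

[2n+1∸1]/2≡n : ∀ n → (2 * n + 1 ∸ 1) / 2 ≡ n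
[2n+1∸1]/2≡n n = trans (cong (_/ 2) (trans (m+n∸n≡m (2 * n) 1) (*-comm 2 n))) (m*n/n≡m n 2)

odd*m≡2*n⇒even : ∀ k m n → (2 * k + 1) * m ≡ 2 * n → m ≡ 2 * (m / 2)
odd*m≡2*n⇒even k m n eq = begin
    m                    ≡⟨ m≡m%n+[m/n]*n m 2 ⟩
    m % 2 + m / 2 * 2    ≡⟨ cong (_+ m / 2 * 2) m%2≡0 ⟩
    m / 2 * 2            ≡⟨ *-comm (m / 2) 2 ⟩
    2 * (m / 2)          ∎
  where
  open ≡-Reasoning
  expand : ∀ k m → (2 * k + 1) * m ≡ m + k * m * 2
  expand = solve-∀
  m%2≡0 : m % 2 ≡ 0
  m%2≡0 = begin
    m % 2                  ≡⟨ [m+kn]%n≡m%n m (k * m) 2 ⟨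
    (m + k * m * 2) % 2    ≡⟨ cong (_% 2) (trans (sym (expand k m)) eq) ⟩
    2 * n % 2              ≡⟨ cong (_% 2) (*-comm 2 n) ⟩
    n * 2 % 2              ≡⟨ m*n%n≡0 n 2 ⟩
    0                      ∎

-- S and D are the numbers of same-class and different-class pairs on a line of PG(2, q).
delandtsheer-doyen : ∀ q c d S D → q * q + q + 1 ≡ c * d → 2 * S + 1 ≡ c →
                     2 * (S + D) + suc q ≡ suc q * suc q →
                     S ≡ (c ∸ 1) / 2 × D ≡ (d ∸ 1) / 2 * c × 2 * ((d ∸ 1) / 2) + 1 ≡ d
delandtsheer-doyen q c zero S D N≡ c≡ pairs≡ with () ← trans (sym (+-comm (q * q + q) 1)) (trans N≡ (*-zeroʳ c))
delandtsheer-doyen q c (suc d′) S D N≡ refl pairs≡ =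
  sym ([2n+1∸1]/2≡n S) , D≡ , d-odd
  where
  open ≡-Reasoning
  2D≡ : 2 * D ≡ c * d′
  2D≡ = +-cancelʳ-≡ (c + q) _ _ (begin
    2 * D + (c + q)             ≡⟨ regroup S D q ⟩
    2 * (S + D) + suc q         ≡⟨ pairs≡ ⟩
    suc q * suc q               ≡⟨ square q ⟩
    q * q + q + 1 + q           ≡⟨ cong (_+ q) N≡ ⟩
    c * suc d′ + q              ≡⟨ distribute c d′ q ⟩
    c * d′ + (c + q)            ∎)
    where
    regroup : ∀ S D q → 2 * D + ((2 * S + 1) + q) ≡ 2 * (S + D) + suc q
    regroup = solve-∀
    square : ∀ q → suc q * suc q ≡ q * q + q + 1 + q
    square = solve-∀
    distribute : ∀ c d q → c * suc d + q ≡ c * d + (c + q)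
    distribute = solve-∀
  d′-even : d′ ≡ 2 * (d′ / 2)
  d′-even = odd*m≡2*n⇒even S d′ D (sym 2D≡)
  D≡ : D ≡ d′ / 2 * c
  D≡ = *-cancelˡ-≡ D (d′ / 2 * c) 2 (begin
    2 * D                 ≡⟨ 2D≡ ⟩
    c * d′                ≡⟨ cong (c *_) d′-even ⟩
    c * (2 * (d′ / 2))    ≡⟨ rotate c (d′ / 2) ⟩
    2 * (d′ / 2 * c)      ∎)
    where
    rotate : ∀ c h → c * (2 * h) ≡ 2 * (h * c)
    rotate = solve-∀
  d-odd : 2 * (d′ / 2) + 1 ≡ suc d′
  d-odd = trans (+-comm (2 * (d′ / 2)) 1) (cong suc (sym d′-even))

module ProjectivePlane {q : ℕ} (F : FiniteField q) where
  open FiniteField F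
  open PG F

  ring : CommutativeRing 0ℓ 0ℓ
  ring = record { isCommutativeRing = isCommutativeRing }

  open CommutativeRing ring using (zeroˡ; zeroʳ; -‿inverseʳ; distribʳ)
    renaming (+-identityˡ to +F-identityˡ; +-identityʳ to +F-identityʳ; *-identityˡ to *F-identityˡ; *-identityʳ to *F-identityʳ)
  open import Algebra.Solver.Ring.NaturalCoefficients.Default (CommutativeRing.commutativeSemiring ring)
    using (solve; _:+_; _:*_; _:=_)

  -- The solver works over the semiring reduct, so -1 enters identities as an opaque constant.
  -1F : Carrier
  -1F = -F 1F

  x-x≡0 : ∀ x → x +F -1F *F x ≡ 0F
  x-x≡0 x = begin
    x +F -1F *F x          ≡⟨ cong (_+F -1F *F x) (*F-identityˡ x) ⟨
    1F *F x +F -1F *F x    ≡⟨ distribʳ x 1F -1F ⟨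
    (1F +F -1F) *F x       ≡⟨ cong (_*F x) (-‿inverseʳ 1F) ⟩
    0F *F x                ≡⟨ zeroˡ x ⟩
    0F                     ∎
    where open ≡-Reasoning

  1≢0 : 1F ≢ 0F
  1≢0 1≡0 = 0≢1 (sym 1≡0)

  nonzero-*≡0 : ∀ {a b} → a ≢ 0F → a *F b ≡ 0F → b ≡ 0F
  nonzero-*≡0 {a} {b} a≢0 ab≡0 with a⁻¹ , aa⁻¹≡1 ← inverse a a≢0 = begin
    b                  ≡⟨ *F-identityˡ b ⟨
    1F *F b            ≡⟨ cong (_*F b) aa⁻¹≡1 ⟨
    (a *F a⁻¹) *F b    ≡⟨ solve 3 (λ a a⁻¹ b → (a :* a⁻¹) :* b := a⁻¹ :* (a :* b)) refl a a⁻¹ b ⟩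
    a⁻¹ *F (a *F b)    ≡⟨ cong (a⁻¹ *F_) ab≡0 ⟩
    a⁻¹ *F 0F          ≡⟨ zeroʳ a⁻¹ ⟩
    0F                 ∎
    where open ≡-Reasoning

  elems-unique : Unique elems
  elems-unique = Unique.map⁺ injective (Unique.allFin⁺ q)
    where
    injective : ∀ {i j} → Inverse.to enum i ≡ Inverse.to enum j → i ≡ j
    injective {i} {j} eq = trans (sym (Inverse.strictlyInverseʳ enum i))
                                 (trans (cong (Inverse.from enum) eq) (Inverse.strictlyInverseʳ enum j))

  ∈-elems : ∀ x → x ∈ elems
  ∈-elems x = subst (_∈ elems) (Inverse.strictlyInverseˡ enum x) (∈-map⁺ (Inverse.to enum) (∈-allFin _))

  length-elems : length elems ≡ q
  length-elems = trans (length-map (Inverse.to enum) (allFin q)) (length-tabulate {n = q} (λ i → i))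

  ∑-roots-nonzero : ∀ α β → β ≢ 0F → ∑ (λ z → 𝟙 ((α +F β *F z) ≟F 0F)) elems ≡ 1
  ∑-roots-nonzero α β β≢0 with β⁻¹ , ββ⁻¹≡1 ← inverse β β≢0 =
    trans (∑-ext elems (λ z → trans (𝟙-cong (root⇒≡ z) (≡⇒root z) _ (w ≟F z)) (sym (*-identityʳ _))))
          (∑-select _≟F_ (λ _ → 1) w elems elems-unique (∈-elems w))
    where
    open ≡-Reasoning
    w = β⁻¹ *F (-1F *F α)
    root⇒≡ : ∀ z → α +F β *F z ≡ 0F → w ≡ z
    root⇒≡ z root = begin
      β⁻¹ *F (-1F *F α)                ≡⟨ cong (β⁻¹ *F_) βz≡-α ⟨
      β⁻¹ *F (β *F z)                  ≡⟨ solve 3 (λ β⁻¹ β z → β⁻¹ :* (β :* z) := (β :* β⁻¹) :* z) refl β⁻¹ β z ⟩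
      (β *F β⁻¹) *F z                  ≡⟨ trans (cong (_*F z) ββ⁻¹≡1) (*F-identityˡ z) ⟩
      z                                ∎
      where
      βz≡-α : β *F z ≡ -1F *F α
      βz≡-α = begin
        β *F z                               ≡⟨ +F-identityʳ _ ⟨
        β *F z +F 0F                         ≡⟨ cong (β *F z +F_) (x-x≡0 α) ⟨
        β *F z +F (α +F -1F *F α)            ≡⟨ solve 4 (λ β z α m → β :* z :+ (α :+ m :* α) := (α :+ β :* z) :+ m :* α) refl β z α -1F ⟩
        (α +F β *F z) +F -1F *F α            ≡⟨ cong (_+F -1F *F α) root ⟩
        0F +F -1F *F α                       ≡⟨ +F-identityˡ _ ⟩
        -1F *F α                             ∎
    ≡⇒root : ∀ z → w ≡ z → α +F β *F z ≡ 0F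
    ≡⇒root z refl = begin
      α +F β *F (β⁻¹ *F (-1F *F α))         ≡⟨ solve 4 (λ α β β⁻¹ x → α :+ β :* (β⁻¹ :* x) := α :+ (β :* β⁻¹) :* x) refl α β β⁻¹ (-1F *F α) ⟩
      α +F (β *F β⁻¹) *F (-1F *F α)         ≡⟨ cong (λ t → α +F t *F (-1F *F α)) ββ⁻¹≡1 ⟩
      α +F 1F *F (-1F *F α)                 ≡⟨ cong (α +F_) (*F-identityˡ _) ⟩
      α +F -1F *F α                         ≡⟨ x-x≡0 α ⟩
      0F                                    ∎

  ∑-roots-zero : ∀ α β → β ≡ 0F → ∑ (λ z → 𝟙 ((α +F β *F z) ≟F 0F)) elems ≡ q * 𝟙 (α ≟F 0F)
  ∑-roots-zero α β refl =
    trans (∑-ext elems (λ z → 𝟙-cong (subst (_≡ 0F) (α+0z≡α z)) (subst (_≡ 0F) (sym (α+0z≡α z))) _ (α ≟F 0F)))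
          (trans (∑-const _ elems) (cong (_* 𝟙 (α ≟F 0F)) length-elems))
    where
    α+0z≡α : ∀ z → α +F 0F *F z ≡ α
    α+0z≡α z = trans (cong (α +F_) (zeroˡ z)) (+F-identityʳ α)

  affine-points : List Point
  affine-points = cartesianProductWith pt1 elems elems

  infinite-points : List Point
  infinite-points = map pt2 elems ++ pt3 ∷ []

  pointsList≡ : pointsList ≡ affine-points ++ infinite-points
  pointsList≡ = cong (_++ infinite-points) (grid elems)
    where
    grid : ∀ ys → concatMap (λ y → map (pt1 y) elems) ys ≡ cartesianProductWith pt1 ys elems
    grid []       = refl
    grid (y ∷ ys) = cong (map (pt1 y) elems ++_) (grid ys)

  ∈-points : ∀ p → p ∈ pointsList
  ∈-points p = subst (p ∈_) (sym pointsList≡) (∈-split p)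
    where
    ∈-split : ∀ p → p ∈ affine-points ++ infinite-points
    ∈-split (pt1 y z) = ∈-++⁺ˡ (∈-cartesianProductWith⁺ pt1 (∈-elems y) (∈-elems z))
    ∈-split (pt2 z)   = ∈-++⁺ʳ affine-points (∈-++⁺ˡ (∈-map⁺ pt2 (∈-elems z)))
    ∈-split pt3       = ∈-++⁺ʳ affine-points (∈-++⁺ʳ (map pt2 elems) (here refl))

  points-unique : Unique pointsList
  points-unique = subst Unique (sym pointsList≡)
    (Unique.++⁺ (Unique.cartesianProductWith⁺ pt1 pt1-injective elems-unique elems-unique)
                (Unique.++⁺ (Unique.map⁺ (λ { refl → refl }) elems-unique) (All.[] AllPairs.∷ AllPairs.[])
                            (λ { (p∈ , here refl) → pt2≢pt3 p∈ }))
                (λ (p∈affine , p∈infinite) → affine∉infinite p∈affine p∈infinite))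
    where
    pt1-injective : ∀ {y y′ z z′} → pt1 y z ≡ pt1 y′ z′ → y ≡ y′ × z ≡ z′
    pt1-injective refl = refl , refl
    pt2≢pt3 : ¬ pt3 ∈ map pt2 elems
    pt2≢pt3 p∈ with _ , _ , () ← ∈-map⁻ pt2 p∈
    affine∉infinite : ∀ {p} → p ∈ affine-points → ¬ p ∈ infinite-points
    affine∉infinite p∈affine p∈infinite with _ , _ , _ , _ , refl ← ∈-cartesianProductWith⁻ pt1 elems elems p∈affine
      with ∈-++⁻ (map pt2 elems) p∈infinite
    ... | inj₁ p∈ with _ , _ , () ← ∈-map⁻ pt2 p∈
    ... | inj₂ (here ())

  Vec3 : Set
  Vec3 = Carrier × Carrier × Carrier

  infix 30 _·_
  _·_ : Vec3 → Vec3 → Carrier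
  (a , b , c) · (x , y , z) = a *F x +F b *F y +F c *F z

  IsZero : Vec3 → Set
  IsZero (a , b , c) = a ≡ 0F × b ≡ 0F × c ≡ 0F

  I≡· : ∀ p L → (p I L) ≡ (coords L · coords p ≡ 0F)
  I≡· (pt1 _ _) (pt1 _ _) = refl
  I≡· (pt1 _ _) (pt2 _)   = refl
  I≡· (pt1 _ _) pt3       = refl
  I≡· (pt2 _)   (pt1 _ _) = refl
  I≡· (pt2 _)   (pt2 _)   = refl
  I≡· (pt2 _)   pt3       = refl
  I≡· pt3       (pt1 _ _) = refl
  I≡· pt3       (pt2 _)   = refl
  I≡· pt3       pt3       = refl

  I⇒· : ∀ {p L} → p I L → coords L · coords p ≡ 0F
  I⇒· {p} {L} = subst (λ A → A) (I≡· p L)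

  ·⇒I : ∀ {p L} → coords L · coords p ≡ 0F → p I L
  ·⇒I {p} {L} = subst (λ A → A) (sym (I≡· p L))

  HasNonzeroEntry : Vec3 → Set
  HasNonzeroEntry (a , b , c) = a ≢ 0F ⊎ b ≢ 0F ⊎ c ≢ 0F

  nonzero-entry⇒¬IsZero : ∀ v → HasNonzeroEntry v → ¬ IsZero v
  nonzero-entry⇒¬IsZero _ (inj₁ a≢0)        (a≡0 , _)     = a≢0 a≡0
  nonzero-entry⇒¬IsZero _ (inj₂ (inj₁ b≢0)) (_ , b≡0 , _) = b≢0 b≡0
  nonzero-entry⇒¬IsZero _ (inj₂ (inj₂ c≢0)) (_ , _ , c≡0) = c≢0 c≡0

  coords-nonzero-entry : ∀ p → HasNonzeroEntry (coords p)
  coords-nonzero-entry (pt1 _ _) = inj₁ 1≢0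
  coords-nonzero-entry (pt2 _)   = inj₂ (inj₁ 1≢0)
  coords-nonzero-entry pt3       = inj₂ (inj₂ 1≢0)

  ∑-pointsList : ∀ (f : Point → ℕ) →
    ∑ f pointsList ≡ ∑ (λ y → ∑ (λ z → f (pt1 y z)) elems) elems + (∑ (λ z → f (pt2 z)) elems + (f pt3 + 0))
  ∑-pointsList f = begin
    ∑ f pointsList                               ≡⟨ cong (∑ f) pointsList≡ ⟩
    ∑ f (affine-points ++ infinite-points)       ≡⟨ ∑-++ f affine-points infinite-points ⟩
    ∑ f affine-points + ∑ f infinite-points      ≡⟨ cong₂ _+_ (∑-cartesianProductWith f pt1 elems elems)
                                                    (trans (∑-++ f (map pt2 elems) _) (cong (_+ (f pt3 + 0)) (∑-map f pt2 elems))) ⟩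
    ∑ (λ y → ∑ (λ z → f (pt1 y z)) elems) elems + (∑ (λ z → f (pt2 z)) elems + (f pt3 + 0)) ∎
    where open ≡-Reasoning

  module _ (a b c : Carrier) where

    zeros-affine : ℕ
    zeros-affine = ∑ (λ y → ∑ (λ z → 𝟙 ((a *F 1F +F b *F y +F c *F z) ≟F 0F)) elems) elems

    zeros-pt2 : ℕ
    zeros-pt2 = ∑ (λ z → 𝟙 ((a *F 0F +F b *F 1F +F c *F z) ≟F 0F)) elems

    zero-pt3 : ℕ
    zero-pt3 = 𝟙 ((a *F 0F +F b *F 0F +F c *F 1F) ≟F 0F)

    zero-pt3≡ : zero-pt3 ≡ 𝟙 (c ≟F 0F)
    zero-pt3≡ = 𝟙-cong (trans (sym value)) (trans value) _ _
      where
      value : a *F 0F +F b *F 0F +F c *F 1F ≡ c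
      value = trans (cong₂ (λ x y → x +F y +F c *F 1F) (zeroʳ a) (zeroʳ b))
                (trans (cong (_+F c *F 1F) (+F-identityˡ 0F)) (trans (+F-identityˡ _) (*F-identityʳ c)))

    zeros-pt2-c≡0 : c ≡ 0F → zeros-pt2 ≡ q * 𝟙 (b ≟F 0F)
    zeros-pt2-c≡0 c≡0 = trans (∑-roots-zero _ c c≡0) (cong (q *_) (𝟙-cong (trans (sym value)) (trans value) _ _))
      where
      value : a *F 0F +F b *F 1F ≡ b
      value = trans (cong₂ _+F_ (zeroʳ a) (*F-identityʳ b)) (+F-identityˡ b)

    zeros-affine-c≢0 : c ≢ 0F → zeros-affine ≡ q
    zeros-affine-c≢0 c≢0 = trans (∑-ext elems (λ y → ∑-roots-nonzero _ c c≢0))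
                                 (trans (∑-const 1 elems) (trans (*-identityʳ _) length-elems))

    zeros-affine-c≡0 : c ≡ 0F → zeros-affine ≡ q * ∑ (λ y → 𝟙 ((a *F 1F +F b *F y) ≟F 0F)) elems
    zeros-affine-c≡0 c≡0 = trans (∑-ext elems (λ y → ∑-roots-zero _ c c≡0)) (∑-*ˡ q _ elems)

    ∑-zeros-of-form : ¬ IsZero (a , b , c) → ∑ (λ p → 𝟙 ((a , b , c) · coords p ≟F 0F)) pointsList ≡ suc q
    ∑-zeros-of-form nonzero = trans (∑-pointsList _) (trans (by-cases (c ≟F 0F) (b ≟F 0F)) (+-comm q 1))
      where
      add₃ : ∀ {x y z x′ y′ z′} → x ≡ x′ → y ≡ y′ → z ≡ z′ → x + (y + (z + 0)) ≡ x′ + (y′ + (z′ + 0))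
      add₃ refl refl refl = refl
      by-cases : Dec (c ≡ 0F) → Dec (b ≡ 0F) → zeros-affine + (zeros-pt2 + (zero-pt3 + 0)) ≡ q + 1
      by-cases (no c≢0) _ =
        add₃ (zeros-affine-c≢0 c≢0) (∑-roots-nonzero _ c c≢0) (trans zero-pt3≡ (𝟙-no (c ≟F 0F) c≢0))
      by-cases (yes c≡0) (no b≢0) =
        add₃ (trans (zeros-affine-c≡0 c≡0) (trans (cong (q *_) (∑-roots-nonzero _ b b≢0)) (*-identityʳ q)))
             (trans (zeros-pt2-c≡0 c≡0) (trans (cong (q *_) (𝟙-no (b ≟F 0F) b≢0)) (*-zeroʳ q)))
             (trans zero-pt3≡ (𝟙-yes (c ≟F 0F) c≡0))
      by-cases (yes c≡0) (yes b≡0) =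
        add₃ (trans (zeros-affine-c≡0 c≡0) (trans (cong (q *_) (∑-roots-zero _ b b≡0))
               (trans (cong (λ t → q * (q * t)) (𝟙-no (_ ≟F 0F) a·1≢0)) (trans (cong (q *_) (*-zeroʳ q)) (*-zeroʳ q)))))
             (trans (zeros-pt2-c≡0 c≡0) (trans (cong (q *_) (𝟙-yes (b ≟F 0F) b≡0)) (*-identityʳ q)))
             (trans zero-pt3≡ (𝟙-yes (c ≟F 0F) c≡0))
        where
        a·1≢0 : a *F 1F ≢ 0F
        a·1≢0 a·1≡0 = nonzero (trans (sym (*F-identityʳ a)) a·1≡0 , b≡0 , c≡0)

  line-size : ∀ L → ∑ (λ p → 𝟙 (p I? L)) pointsList ≡ suc q
  line-size L = trans (∑-ext pointsList (λ p → 𝟙-cong (I⇒· {p} {L}) (·⇒I {p} {L}) (p I? L) _)) 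
    (∑-zeros-of-form _ _ _ (nonzero-entry⇒¬IsZero _ (coords-nonzero-entry L)))

  cross : Vec3 → Vec3 → Vec3
  cross (a , b , c) (a′ , b′ , c′) =
    b *F c′ +F -1F *F (c *F b′) , c *F a′ +F -1F *F (a *F c′) , a *F b′ +F -1F *F (b *F a′)

  ·-cross-left : ∀ u u′ → u · cross u u′ ≡ 0F
  ·-cross-left (a , b , c) (a′ , b′ , c′) = trans
    (solve 7 (λ m a b c a′ b′ c′ →
       a :* (b :* c′ :+ m :* (c :* b′)) :+ b :* (c :* a′ :+ m :* (a :* c′)) :+ c :* (a :* b′ :+ m :* (b :* a′))
       := (a :* b :* c′ :+ a′ :* b :* c :+ a :* b′ :* c) :+ m :* (a :* b :* c′ :+ a′ :* b :* c :+ a :* b′ :* c))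
       refl -1F a b c a′ b′ c′)
    (x-x≡0 _)

  ·-cross-right : ∀ u u′ → u′ · cross u u′ ≡ 0F
  ·-cross-right (a , b , c) (a′ , b′ , c′) = trans
    (solve 7 (λ m a b c a′ b′ c′ →
       a′ :* (b :* c′ :+ m :* (c :* b′)) :+ b′ :* (c :* a′ :+ m :* (a :* c′)) :+ c′ :* (a :* b′ :+ m :* (b :* a′))
       := (a′ :* b :* c′ :+ a′ :* b′ :* c :+ a :* b′ :* c′) :+ m :* (a′ :* b :* c′ :+ a′ :* b′ :* c :+ a :* b′ :* c′))
       refl -1F a b c a′ b′ c′)
    (x-x≡0 _)

  scale : Carrier → Vec3 → Vec3
  scale k (w₁ , w₂ , w₃) = w₁ *F k , w₂ *F k , w₃ *F k

  ·-scale : ∀ u k w → u · scale k w ≡ (u · w) *F k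
  ·-scale (a , b , c) k (w₁ , w₂ , w₃) =
    solve 7 (λ a b c w₁ w₂ w₃ k → a :* (w₁ :* k) :+ b :* (w₂ :* k) :+ c :* (w₃ :* k)
                                  := (a :* w₁ :+ b :* w₂ :+ c :* w₃) :* k) refl a b c w₁ w₂ w₃ k

  vanishes : ∀ {w} → w ≡ 0F → ∀ k → 0F ≡ w *F k
  vanishes refl k = sym (zeroˡ k)

  normalise : ∀ w → ¬ IsZero w → ∃ λ p → ∃ λ k → coords p ≡ scale k w
  normalise (w₁ , w₂ , w₃) nonzero with w₁ ≟F 0F | w₂ ≟F 0F | w₃ ≟F 0F
  ... | no w₁≢0 | _ | _ with k , w₁k≡1 ← inverse w₁ w₁≢0 =
    pt1 (w₂ *F k) (w₃ *F k) , k , cong (_, w₂ *F k , w₃ *F k) (sym w₁k≡1)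
  ... | yes w₁≡0 | no w₂≢0 | _ with k , w₂k≡1 ← inverse w₂ w₂≢0 =
    pt2 (w₃ *F k) , k , cong₂ _,_ (vanishes w₁≡0 k) (cong (_, w₃ *F k) (sym w₂k≡1))
  ... | yes w₁≡0 | yes w₂≡0 | no w₃≢0 with k , w₃k≡1 ← inverse w₃ w₃≢0 =
    pt3 , k , cong₂ _,_ (vanishes w₁≡0 k) (cong₂ _,_ (vanishes w₂≡0 k) (sym w₃k≡1))
  ... | yes w₁≡0 | yes w₂≡0 | yes w₃≡0 = ⊥-elim (nonzero (w₁≡0 , w₂≡0 , w₃≡0))

  private
    drop-zeros : ∀ X z K → X +F 0F *F z +F (K +F -1F *F K) ≡ X
    drop-zeros X z K = begin
      X +F 0F *F z +F (K +F -1F *F K)   ≡⟨ cong₂ (λ s t → X +F s +F t) (zeroˡ z) (x-x≡0 K) ⟩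
      X +F 0F +F 0F                     ≡⟨ trans (+F-identityʳ _) (+F-identityʳ X) ⟩
      X                                 ∎
      where open ≡-Reasoning

    cancel : ∀ {a X a′ S w z w′ y K K′} → a ≢ 0F → S ≡ 0F → w ≡ 0F → w′ ≡ 0F →
             a *F X +F w *F z +F (K′ +F -1F *F K′) ≡ a′ *F S +F w′ *F y +F (K +F -1F *F K) → X ≡ 0F
    cancel {a} {X} {a′} {z = z} {y = y} {K} {K′} a≢0 refl refl refl eq = nonzero-*≡0 a≢0 (begin
      a *F X                                    ≡⟨ drop-zeros (a *F X) z K′ ⟨
      a *F X +F 0F *F z +F (K′ +F -1F *F K′)    ≡⟨ eq ⟩
      a′ *F 0F +F 0F *F y +F (K +F -1F *F K)    ≡⟨ drop-zeros (a′ *F 0F) y K ⟩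
      a′ *F 0F                                  ≡⟨ zeroʳ a′ ⟩
      0F                                        ∎)
      where open ≡-Reasoning

  -- If u × u′ = 0 then u′ is a multiple of u: since u_i (u′·v) - u′_i (u·v) is a combination of the
  -- entries of u × u′, every zero v of the form u is a zero of u′.
  parallel : ∀ u u′ v → HasNonzeroEntry u → IsZero (cross u u′) → u · v ≡ 0F → u′ · v ≡ 0F
  parallel (a , b , c) (a′ , b′ , c′) (x , y , z) (inj₁ a≢0) (_ , w₂≡0 , w₃≡0) u·v≡0 =
    cancel a≢0 u·v≡0 w₂≡0 w₃≡0 (solve 10 (λ m a b c a′ b′ c′ x y z →
        a :* (a′ :* x :+ b′ :* y :+ c′ :* z) :+ (c :* a′ :+ m :* (a :* c′)) :* z :+ (a′ :* b :* y :+ m :* (a′ :* b :* y))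
     := a′ :* (a :* x :+ b :* y :+ c :* z) :+ (a :* b′ :+ m :* (b :* a′)) :* y :+ (a :* c′ :* z :+ m :* (a :* c′ :* z)))
      refl -1F a b c a′ b′ c′ x y z)
  parallel (a , b , c) (a′ , b′ , c′) (x , y , z) (inj₂ (inj₁ b≢0)) (w₁≡0 , _ , w₃≡0) u·v≡0 =
    cancel b≢0 u·v≡0 w₃≡0 w₁≡0 (solve 10 (λ m a b c a′ b′ c′ x y z →
        b :* (a′ :* x :+ b′ :* y :+ c′ :* z) :+ (a :* b′ :+ m :* (b :* a′)) :* x :+ (b′ :* c :* z :+ m :* (b′ :* c :* z))
     := b′ :* (a :* x :+ b :* y :+ c :* z) :+ (b :* c′ :+ m :* (c :* b′)) :* z :+ (b :* a′ :* x :+ m :* (b :* a′ :* x)))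
      refl -1F a b c a′ b′ c′ x y z)
  parallel (a , b , c) (a′ , b′ , c′) (x , y , z) (inj₂ (inj₂ c≢0)) (w₁≡0 , w₂≡0 , _) u·v≡0 =
    cancel c≢0 u·v≡0 w₁≡0 w₂≡0 (solve 10 (λ m a b c a′ b′ c′ x y z →
        c :* (a′ :* x :+ b′ :* y :+ c′ :* z) :+ (b :* c′ :+ m :* (c :* b′)) :* y :+ (c′ :* a :* x :+ m :* (c′ :* a :* x))
     := c′ :* (a :* x :+ b :* y :+ c :* z) :+ (c :* a′ :+ m :* (a :* c′)) :* x :+ (c :* b′ :* y :+ m :* (c :* b′ :* y)))
      refl -1F a b c a′ b′ c′ x y z)

  isZero? : ∀ w → Dec (IsZero w)
  isZero? (a , b , c) = (a ≟F 0F) ×-dec (b ≟F 0F) ×-dec (c ≟F 0F)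

  lines-meet : ∀ L L′ → ∃ λ p → p I L × p I L′
  lines-meet L L′ with isZero? (cross (coords L) (coords L′))
  ... | no nonzero with p , k , coords≡ ← normalise _ nonzero =
    p , ·⇒I {p} {L} (on-spanned (coords L) (·-cross-left (coords L) (coords L′)))
      , ·⇒I {p} {L′} (on-spanned (coords L′) (·-cross-right (coords L) (coords L′)))
    where
    on-spanned : ∀ u → u · cross (coords L) (coords L′) ≡ 0F → u · coords p ≡ 0F
    on-spanned u u·w≡0 = trans (cong (u ·_) coords≡) (trans (·-scale u k _) (trans (cong (_*F k) u·w≡0) (zeroˡ k)))
  ... | yes cross≡0 with p , p∈L ← ∑𝟙≡suc⇒∃ (_I? L) pointsList (line-size L) =
    p , p∈L , ·⇒I {p} {L′} (parallel (coords L) (coords L′) (coords p) (coords-nonzero-entry L) cross≡0 (I⇒· {p} {L} p∈L))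

n<2^n : ∀ n → n < 2 ^ n
n<2^n zero    = s≤s z≤n
n<2^n (suc n) = +-mono-≤ (m^n>0 2 n) (≤-trans (n<2^n n) (m≤m+n (2 ^ n) 0))

N<t/2 : ∀ N t → (N + 1) * 2 ≤ t → N < t / 2
N<t/2 N t le = ≤-trans (≤-reflexive (trans (+-comm 1 N) (sym (m*n/n≡m (N + 1) 2)))) (/-monoˡ-≤ 2 le)

-- x⁴ + x² + 1 = (x² + x + 1)(x² - x + 1), written with x = 1 + y
square-factorisation : ∀ y → let x = suc y in
                       (x * x) * (x * x) + x * x + 1 ≡ (x * x + x + 1) * (x * y + 1)
square-factorisation = solve-∀

factor-bounds : ∀ N y → N + 2 ≤ y → let x = suc y in
                2 ≤ x * x + x + 1 × 2 ≤ x * y + 1 × N < (x * y + 1 ∸ 1) / 2 × N < (x * x + x + 1 ∸ 1) / 2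
factor-bounds N y N+2≤y =
    +-monoˡ-≤ 1 (≤-trans (s≤s z≤n) (m≤n+m x (x * x)))
  , +-monoˡ-≤ 1 (*-mono-≤ {1} {x} (s≤s z≤n) 1≤y)
  , N<t/2 N _ (≤-trans big (≤-reflexive (sym (m+n∸n≡m (x * y) 1))))
  , N<t/2 N _ (≤-trans big (≤-trans (*-monoʳ-≤ x (n≤1+n y))
                                    (≤-trans (m≤m+n (x * x) x) (≤-reflexive (sym (m+n∸n≡m (x * x + x) 1))))))
  where
  x = suc y
  1≤y : 1 ≤ y
  1≤y = ≤-trans (s≤s z≤n) (≤-trans (m≤n+m 2 N) N+2≤y)
  big : (N + 1) * 2 ≤ x * y
  big = *-mono-≤ (≤-trans (+-monoʳ-≤ N (s≤s z≤n)) (≤-trans N+2≤y (n≤1+n y))) (≤-trans (m≤n+m 2 N) N+2≤y)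

-- q = 4^k with k = N + 3, c = q + 2^k + 1 and d = q - 2^k + 1
unbounded-parameters : ∀ N → ∃ λ q → ∃ λ c → ∃ λ d → IsPrimePower q × 2 ≤ c × 2 ≤ d
                       × q * q + q + 1 ≡ c * d × N < (d ∸ 1) / 2 × N < (c ∸ 1) / 2
unbounded-parameters N with 2 ^ (N + 3) in 2^k≡x | n<2^n (N + 3)
... | suc y | k<x with factor-bounds N y (≤-trans (+-monoʳ-≤ N (n≤1+n 2)) (≤-pred k<x))
...   | c≥2 , d≥2 , m>N , n>N =
  x * x , x * x + x + 1 , x * y + 1 , prime-power , c≥2 , d≥2 , square-factorisation y , m>N , n>N
  where
  x = suc y
  k = N + 3
  prime-power : IsPrimePower (x * x)
  prime-power = 2 , k + k , prime[2] , ≤-trans (≤-trans (s≤s z≤n) (m≤n+m 3 N)) (m≤m+n k k)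
              , trans (cong₂ _*_ (sym 2^k≡x) (sym 2^k≡x)) (sym (^-distribˡ-+-* 2 k k))

module SingerCycle {q : ℕ} (F : FiniteField q) (c d : ℕ) .{{_ : NonZero c}} .{{_ : NonZero d}}
  (N≡ : q * q + q + 1 ≡ c * d)
  (σ : PG.Point F ↔ PG.Point F) (collineation : PG.IsCollineation F σ)
  (period : ∀ p → iter (c * d) (Inverse.to σ) p ≡ p)
  (free   : ∀ p i → 0 < i → i < c * d → iter i (Inverse.to σ) p ≢ p)
  (transitive : ∀ p p′ → ∃ λ i → iter i (Inverse.to σ) p ≡ p′) where

  open PG F
  open ProjectivePlane F
  open Imprimitive (Inverse.to σ) c d period free transitive public
  open Coordinates pt3 public
  open IncidenceCounts _≟P_ _I_ _I?_ pointsList points-unique ∈-points q line-size lines-meet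
  open ClassPairs (Inverse.to σ) c d N≡ period free transitive collineation

  parameters : ∀ L → samePairs L ≡ (c ∸ 1) / 2 × diffPairs L ≡ (d ∸ 1) / 2 * c × 2 * ((d ∸ 1) / 2) + 1 ≡ d
  parameters L = delandtsheer-doyen q c d (samePairs L) (diffPairs L) N≡ (samePairs-odd L) (pairs-on-line L)

  c-odd : 2 * ((c ∸ 1) / 2) + 1 ≡ c
  c-odd = trans (cong (λ n → 2 * n + 1) (sym (proj₁ (parameters pt3)))) (samePairs-odd pt3)

  ranks : ∀ x → HasOrbitCount (SameClass x) (HOrbit x) (2 * ((c ∸ 1) / 2) + 1)
              × HasOrbitCount (λ _ → ⊤) (KOrbit x) (2 * ((d ∸ 1) / 2) + 1)
  ranks x = subst (HasOrbitCount (SameClass x) (HOrbit x)) (sym c-odd) (rankH x)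
          , subst (HasOrbitCount (λ _ → ⊤) (KOrbit x)) (sym (proj₂ (proj₂ (parameters pt3)))) (rankK x)


lemma4p2 :
  ( (q : ℕ) → IsPrimePower q → (F : FiniteField q) → (c d : ℕ) → 2 ≤ c → 2 ≤ d
    → q * q + q + 1 ≡ c * d
    → (σ : PG.Point F ↔ PG.Point F) → PG.IsCollineation F σ
    → (∀ p → iter (c * d) (Inverse.to σ) p ≡ p)
    → (∀ p i → 0 < i → i < c * d → iter i (Inverse.to σ) p ≢ p)
    → (∀ p p' → ∃ λ i → iter i (Inverse.to σ) p ≡ p')
    → let open PG F
          open Classes (Inverse.to σ) c d
          m = (d ∸ 1) / 2
          n = (c ∸ 1) / 2
      in
      -- (a) Delandtsheer–Doyen parameters
      (∀ L → samePairs L ≡ n × diffPairs L ≡ m * c)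
      -- (b) embedding of G into Z_c ≀ Z_d (imprimitive action), classes ↦ fibres
      × (Σ (Point ↔ (Fin c × Fin d)) λ φ →
           (∀ p p' → SameClass p p' ⇔ (proj₂ (Inverse.to φ p) ≡ proj₂ (Inverse.to φ p')))
           × (∀ i → ∃ λ (t : ℕ) → ∃ λ (f : Fin d → ℕ) → ∀ p →
                (toℕ (proj₂ (Inverse.to φ (iter i (Inverse.to σ) p)))
                   ≡ toℕ (proj₂ (Inverse.to φ p)) + t [mod d ])
                × (toℕ (proj₁ (Inverse.to φ (iter i (Inverse.to σ) p)))
                   ≡ toℕ (proj₁ (Inverse.to φ p)) + f (proj₂ (Inverse.to φ p)) [mod c ])))
      -- (c) ranks
      × (∀ x → RankH x (2 * n + 1) × RankK x (2 * m + 1)) )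
  -- (d)
  × (∀ (N : ℕ) → ∃ λ q → ∃ λ c → ∃ λ d → IsPrimePower q × 2 ≤ c × 2 ≤ d
       × q * q + q + 1 ≡ c * d × N < (d ∸ 1) / 2 × N < (c ∸ 1) / 2)
lemma4p2 = (λ where
    q _ F c@(suc _) d@(suc _) _ _ N≡ σ collineation period free transitive →
      let open SingerCycle F c d N≡ σ collineation period free transitive in
      (λ L → proj₁ (parameters L) , proj₁ (proj₂ (parameters L)))
      , (coordinates , SameClass⇔coord₂ , coord-iter)
      , ranks)
  , unbounded-parameters
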